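{- Let $H$ be a triangle-free $2$-connected cubic graph with $n \geq 8$ vertices, and let $G$ be obtained from $H$ by bridging a pair of edges of $H$ with cycle spread at least $(1,1)$. Then at least one of the following holds: (i) $H \cong Q_{2k}$ and $G \cong Q_{2(k+1)}$ for some $k \geq 4$; (ii) $H \cong V_{2k}$ and $G \cong V_{2(k+1)}$ for some $k \geq 4$; (iii) $G$ is (isomorphic to a graph) obtained from $H$ by bridging a pair of edges of $H$ with cycle spread at least $(1,2)$.
   Context: Graphs are finite and simple. A cubic graph is one in which every vertex has degree $3$. A triangle-free graph has no cycle of length $3$. Bridging: given two distinct edges $ab$ and $cd$ of a graph, subdivide $ab$ by a new vertex $x$ (replacing $ab$ by the path $a x b$) and $cd$ by a new vertex $y$ (replacing $cd$ by $c y d$), and add the edge $xy$. The resulting graph (with new edges $xa, xb, yc, yd, xy$) is said to be obtained by bridging the pair $ab, cd$. Cycle spread: let $ab$ and $cd$ be two edges of a $2$-connected graph and let $C$ be a smallest cycle containing both. Removing the two edges from $C$ leaves two paths joining them; labelling so that these paths join $a$ to $c$ and $b$ to $d$ and the $a$–$c$ path is no longer than the $b$–$d$ path, the cycle spread of $ab, cd$ is the pair $(i,j)$, $i \le j$, of the lengths of these two paths (by convention an edge with itself has cycle spread $(0,0)$). Pairs are compared lexicographically. Thus two edges have cycle spread at least $(1,1)$ exactly when they are distinct and non-adjacent (share no end vertex), and cycle spread at least $(1,2)$ exactly when they are non-adjacent and there is no $4$-cycle containing both of them. $Q_{2k}$ (the ladder, $k\ge 4$) is the graph on $2k$ vertices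 consisting of two $k$-cycles $u_1u_2\cdots u_k u_1$ and $v_1 v_2\cdots v_k v_1$ together with the edges $u_iv_i$, $1\le i\le k$ (so $Q_8$ is the cube). $V_{2k}$ (the Möbius ladder) is the graph obtained from a $2k$-cycle $w_0w_1\cdots w_{2k-1}w_0$ by adding the edges $w_iw_{i+k}$ for $0\le i\le k-1$. -}

module Defs where

open import Data.Nat using (ℕ; zero; suc; _+_; _*_; _≤_; _≡ᵇ_)
open import Data.Fin using (Fin; zero; suc; toℕ; _≟_)
open import Data.Bool using (Bool; true; false; _∧_; _∨_; not; _xor_)
open import Data.List using (List; length; filterᵇ; allFin)
open import Data.Product using (_×_; Σ; ∃-syntax)
open import Data.Sum using (_⊎_)
open import Data.Empty using (⊥)
open import Relation.Nullary using (¬_)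
open import Relation.Nullary.Decidable using (⌊_⌋)
open import Relation.Binary.PropositionalEquality using (_≡_; _≢_)
open import Function.Bundles using (_↔_; Inverse)

Graph : Set → Set
Graph V = V → V → Bool

record IsSimple {V : Set} (G : Graph V) : Set where
  field
    symmetric : ∀ u v → G u v ≡ G v u
    loopless  : ∀ u → G u u ≡ false

Edge : {V : Set} → Graph V → V → V → Set
Edge G u v = G u v ≡ true

degree : {n : ℕ} → Graph (Fin n) → Fin n → ℕ
degree {n} G u = length (filterᵇ (G u) (allFin n))

Cubic : {n : ℕ} → Graph (Fin n) → Set
Cubic G = ∀ u → degree G u ≡ 3

TriangleFree : {V : Set} → Graph V → Set
TriangleFree G = ∀ a b c → Edge G a b → Edge G b c → Edge G c a → ⊥

data WalkAvoiding {V : Set} (G : Graph V) (x : V) : V → V → Set where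
  nil  : ∀ {a} → a ≢ x → WalkAvoiding G x a a
  cons : ∀ {a b c} → a ≢ x → Edge G a b → WalkAvoiding G x b c → WalkAvoiding G x a c

TwoConnected : {n : ℕ} → Graph (Fin n) → Set
TwoConnected {n} G = (3 ≤ n) × (∀ x a b → a ≢ x → b ≢ x → WalkAvoiding G x a b)

SpreadAtLeast11 : {V : Set} → Graph V → V → V → V → V → Set
SpreadAtLeast11 G a b c d = (a ≢ c) × (a ≢ d) × (b ≢ c) × (b ≢ d)

FourCycle : {V : Set} → Graph V → V → V → V → V → Set
FourCycle G w0 w1 w2 w3 =
  (w0 ≢ w1) × (w0 ≢ w2) × (w0 ≢ w3) × (w1 ≢ w2) × (w1 ≢ w3) × (w2 ≢ w3) ×
  Edge G w0 w1 × Edge G w1 w2 × Edge G w2 w3 × Edge G w3 w0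

SameEdge : {V : Set} → V → V → V → V → Set
SameEdge u v x y = ((u ≡ x) × (v ≡ y)) ⊎ ((u ≡ y) × (v ≡ x))

EdgeOfFourCycle : {V : Set} → V → V → V → V → V → V → Set
EdgeOfFourCycle u v w0 w1 w2 w3 =
  SameEdge u v w0 w1 ⊎ SameEdge u v w1 w2 ⊎ SameEdge u v w2 w3 ⊎ SameEdge u v w3 w0

SpreadAtLeast12 : {V : Set} → Graph V → V → V → V → V → Set
SpreadAtLeast12 G a b c d =
  SpreadAtLeast11 G a b c d ×
  ¬ (∃[ w0 ] ∃[ w1 ] ∃[ w2 ] ∃[ w3 ]
       (FourCycle G w0 w1 w2 w3 ×
        EdgeOfFourCycle a b w0 w1 w2 w3 × EdgeOfFourCycle c d w0 w1 w2 w3))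

isOneOf : {n : ℕ} → Fin n → Fin n → Fin n → Bool
isOneOf v a b = ⌊ v ≟ a ⌋ ∨ ⌊ v ≟ b ⌋

sameEdgeᵇ : {n : ℕ} → Fin n → Fin n → Fin n → Fin n → Bool
sameEdgeᵇ u v x y = (⌊ u ≟ x ⌋ ∧ ⌊ v ≟ y ⌋) ∨ (⌊ u ≟ y ⌋ ∧ ⌊ v ≟ x ⌋)

-- Bridging the pair ab, cd of G.  New vertex x = zero subdivides ab,
-- new vertex y = suc zero subdivides cd, old vertex v is suc (suc v).
bridge : {n : ℕ} → Graph (Fin n) → Fin n → Fin n → Fin n → Fin n →
         Graph (Fin (suc (suc n)))
bridge G a b c d zero zero = false
bridge G a b c d zero (suc zero) = true
bridge G a b c d zero (suc (suc v)) = isOneOf v a b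
bridge G a b c d (suc zero) zero = true
bridge G a b c d (suc zero) (suc zero) = false
bridge G a b c d (suc zero) (suc (suc v)) = isOneOf v c d
bridge G a b c d (suc (suc u)) zero = isOneOf u a b
bridge G a b c d (suc (suc u)) (suc zero) = isOneOf u c d
bridge G a b c d (suc (suc u)) (suc (suc v)) =
  G u v ∧ not (sameEdgeᵇ u v a b) ∧ not (sameEdgeᵇ u v c d)

record _≅_ {V W : Set} (G : Graph V) (H : Graph W) : Set where
  field
    bij      : V ↔ W
    preserve : ∀ u v → H (Inverse.to bij u) (Inverse.to bij v) ≡ G u v

cycAdj : (m : ℕ) → Fin m → Fin m → Bool
cycAdj m i j =
  (suc (toℕ i) ≡ᵇ toℕ j) ∨ (suc (toℕ j) ≡ᵇ toℕ i) ∨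
  ((toℕ i ≡ᵇ 0) ∧ (suc (toℕ j) ≡ᵇ m)) ∨ ((toℕ j ≡ᵇ 0) ∧ (suc (toℕ i) ≡ᵇ m))

-- Ladder Q_{2k}: (false , i) is u_{i+1}, (true , i) is v_{i+1}
Ladder : (k : ℕ) → Graph (Bool × Fin k)
Ladder k (s Data.Product., i) (t Data.Product., j) =
  (not (s xor t) ∧ cycAdj k i j) ∨ ((s xor t) ∧ ⌊ i ≟ j ⌋)

-- Möbius ladder V_{2k}: vertex i is w_i; 2k-cycle plus w_i w_{i+k}
Mobius : (k : ℕ) → Graph (Fin (2 * k))
Mobius k i j =
  cycAdj (2 * k) i j ∨ (toℕ i + k ≡ᵇ toℕ j) ∨ (toℕ j + k ≡ᵇ toℕ i)

module Submission where

open import Defs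
open import Data.Nat as ℕ using (ℕ; zero; suc; _+_; _*_; _∸_; _≤_; _<_; z≤n; s≤s; _≡ᵇ_; _<ᵇ_)
import Data.Nat.Properties as NP
open import Data.Fin using (Fin; zero; suc; toℕ; fromℕ<; _≟_)
import Data.Fin.Properties as FP
open import Data.Bool using (Bool; true; false; _∧_; _∨_; not; if_then_else_; T; T?)
import Data.Bool.Properties as BP
open import Data.List using (List; []; _∷_; length; filterᵇ; allFin)
open import Data.Product using (Σ; _×_; _,_; proj₁; proj₂; ∃-syntax)
open import Data.Sum using (_⊎_; inj₁; inj₂; [_,_])
open import Data.Empty using (⊥; ⊥-elim)
open import Relation.Nullary using (¬_; Dec; yes; no)
open import Relation.Nullary.Decidable using (⌊_⌋)
open import Relation.Binary.PropositionalEquality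
  using (_≡_; _≢_; refl; sym; trans; cong; cong₂; subst; ≢-sym)
open import Function.Bundles using (Inverse; mk↔ₛ′)
open import Data.List.Membership.Propositional using (_∈_)
open import Data.List.Membership.Propositional.Properties using (∈-filter⁺; ∈-filter⁻; ∈-allFin)
open import Data.List.Relation.Unary.Any using (here; there)
open import Data.List.Relation.Unary.Unique.Propositional using (Unique)
open import Data.List.Relation.Unary.AllPairs using ([]; _∷_)
open import Data.List.Relation.Unary.All using ([]; _∷_)
import Data.List.Relation.Unary.Unique.Propositional.Properties as UP
open import Data.Unit using (tt)

-- If ab, cd have cycle spread (1,1) but not (1,2), a 4-cycle contains both, so (possibly after
-- swapping c and d) a b d c is a square: a piece of ladder with rails a b, c d and rungs a c, b d.
-- In a cubic triangle-free graph, bridging the two rail edges of a square is isomorphic to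
-- bridging the next pair of rail edges b b', d d', where b', d' are the third neighbours of b, d;
-- the isomorphism exchanges the two subdivision vertices with b and d. Walking along the rails
-- this way, either some pair of rail edges lies on no 4-cycle, giving (iii), or every step closes
-- a square. Then the rails return to their start, straight or twisted; by 2-connectivity the
-- closed rails exhaust H, so H is Q_2k or V_2k, and bridging two consecutive rail edges inserts
-- one new rung.

bool-ext : (b c : Bool) → (b ≡ true → c ≡ true) → (c ≡ true → b ≡ true) → b ≡ c
bool-ext false false _ _ = refl
bool-ext false true _ g = g refl
bool-ext true false f _ = sym (f refl)
bool-ext true true _ _ = refl

false≢true : false ≢ true
false≢true ()

∧-trueˡ : ∀ {a b} → a ∧ b ≡ true → a ≡ true
∧-trueˡ {true} _ = refl

∧-trueʳ : ∀ {a b} → a ∧ b ≡ true → b ≡ true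
∧-trueʳ {true} e = e

T⇒≡true : ∀ {b} → T b → b ≡ true
T⇒≡true {true} _ = refl

∨-true : ∀ {a b} → a ∨ b ≡ true → a ≡ true ⊎ b ≡ true
∨-true {true} _ = inj₁ refl
∨-true {false} e = inj₂ e

module _ {n : ℕ} where
  ≟-refl : (a : Fin n) → ⌊ a ≟ a ⌋ ≡ true
  ≟-refl a with a ≟ a
  ... | yes _ = refl
  ... | no ¬p = ⊥-elim (¬p refl)

  ≟-neq : {a b : Fin n} → a ≢ b → ⌊ a ≟ b ⌋ ≡ false
  ≟-neq {a} {b} ne with a ≟ b
  ... | yes p = ⊥-elim (ne p)
  ... | no _ = refl

  ≟-true : {a b : Fin n} → ⌊ a ≟ b ⌋ ≡ true → a ≡ b
  ≟-true {a} {b} e with a ≟ b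
  ... | yes p = p

  dec : (a b : Fin n) → a ≡ b ⊎ a ≢ b
  dec a b with a ≟ b
  ... | yes x = inj₁ x
  ... | no x = inj₂ x

module _ {V W : Set} {G : Graph V} {K : Graph W} where
  mkIso : (f : V → W) (g : W → V) → (∀ y → f (g y) ≡ y) → (∀ x → g (f x) ≡ x) →
          (∀ u v → K (f u) (f v) ≡ G u v) → G ≅ K
  mkIso f g fg gf pr = record { bij = mk↔ₛ′ f g fg gf ; preserve = pr }

  mkIsoFrom : (f : V → W) (g : W → V) → (∀ y → f (g y) ≡ y) → (∀ x → g (f x) ≡ x) →
              (∀ x y → G (g x) (g y) ≡ K x y) → G ≅ K
  mkIsoFrom f g fg gf pr = mkIso f g fg gf λ u v →
    trans (sym (pr (f u) (f v))) (cong₂ G (gf u) (gf v))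

≅-refl : {V : Set} {G : Graph V} → G ≅ G
≅-refl = mkIso (λ x → x) (λ x → x) (λ _ → refl) (λ _ → refl) (λ _ _ → refl)

≅-trans : {U V W : Set} {G : Graph U} {K : Graph V} {L : Graph W} → G ≅ K → K ≅ L → G ≅ L
≅-trans {G = G} {K} {L} i j =
  mkIso (λ x → J.to (I.to x)) (λ y → I.from (J.from y))
    (λ y → trans (cong J.to (I.strictlyInverseˡ (J.from y))) (J.strictlyInverseˡ y))
    (λ x → trans (cong I.from (J.strictlyInverseʳ (I.to x))) (I.strictlyInverseʳ x))
    λ u v → trans (_≅_.preserve j (I.to u) (I.to v)) (_≅_.preserve i u v)
  where module I = Inverse (_≅_.bij i)
        module J = Inverse (_≅_.bij j)

In3 : {V : Set} → V → V → V → V → Set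
In3 v A B C = v ≡ A ⊎ v ≡ B ⊎ v ≡ C

In3-rotate : {V : Set} {v A B C : V} → In3 v A B C → In3 v B C A
In3-rotate (inj₁ x) = inj₂ (inj₂ x)
In3-rotate (inj₂ (inj₁ x)) = inj₁ x
In3-rotate (inj₂ (inj₂ x)) = inj₂ (inj₁ x)

In3-swap : {V : Set} {v A B C : V} → In3 v A B C → In3 v B A C
In3-swap (inj₁ x) = inj₂ (inj₁ x)
In3-swap (inj₂ (inj₁ x)) = inj₁ x
In3-swap (inj₂ (inj₂ x)) = inj₂ (inj₂ x)

In3-map : {V W : Set} (f : V → W) → ∀ {v A B C} → In3 v A B C → In3 (f v) (f A) (f B) (f C)
In3-map f (inj₁ refl) = inj₁ refl
In3-map f (inj₂ (inj₁ refl)) = inj₂ (inj₁ refl)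
In3-map f (inj₂ (inj₂ refl)) = inj₂ (inj₂ refl)

In3-reflect : {V W : Set} (f : V → W) → (∀ {x y} → f x ≡ f y → x ≡ y) → ∀ {v A B C} →
              In3 (f v) (f A) (f B) (f C) → In3 v A B C
In3-reflect f inj (inj₁ e) = inj₁ (inj e)
In3-reflect f inj (inj₂ (inj₁ e)) = inj₂ (inj₁ (inj e))
In3-reflect f inj (inj₂ (inj₂ e)) = inj₂ (inj₂ (inj e))

no-three-in-two : {V : Set} {B C X Y Z : V} → X ≢ Y → X ≢ Z → Y ≢ Z →
                  (X ≡ B ⊎ X ≡ C) → (Y ≡ B ⊎ Y ≡ C) → (Z ≡ B ⊎ Z ≡ C) → ⊥
no-three-in-two xy xz yz (inj₁ refl) (inj₁ refl) _ = xy refl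
no-three-in-two xy xz yz (inj₂ refl) (inj₂ refl) _ = xy refl
no-three-in-two xy xz yz (inj₁ refl) (inj₂ refl) (inj₁ refl) = xz refl
no-three-in-two xy xz yz (inj₁ refl) (inj₂ refl) (inj₂ refl) = yz refl
no-three-in-two xy xz yz (inj₂ refl) (inj₁ refl) (inj₁ refl) = yz refl
no-three-in-two xy xz yz (inj₂ refl) (inj₁ refl) (inj₂ refl) = xz refl

module _ {n : ℕ} where
  In3-dec : (v X Y Z : Fin n) → In3 v X Y Z ⊎ (v ≢ X × v ≢ Y × v ≢ Z)
  In3-dec v X Y Z with v ≟ X | v ≟ Y | v ≟ Z
  ... | yes p | _ | _ = inj₁ (inj₁ p)
  ... | no _ | yes p | _ = inj₁ (inj₂ (inj₁ p))
  ... | no _ | no _ | yes p = inj₁ (inj₂ (inj₂ p))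
  ... | no a | no b | no c = inj₂ (a , b , c)

  In3-cover-first : {A B C X Y Z : Fin n} → X ≢ Y → X ≢ Z → Y ≢ Z →
                    In3 X A B C → In3 Y A B C → In3 Z A B C → In3 A X Y Z
  In3-cover-first {A} {B} {C} {X} {Y} {Z} xy xz yz hX hY hZ with In3-dec A X Y Z
  ... | inj₁ p = p
  ... | inj₂ (a , b , c) = ⊥-elim (no-three-in-two xy xz yz (drop hX a) (drop hY b) (drop hZ c))
    where drop : ∀ {W} → In3 W A B C → A ≢ W → W ≡ B ⊎ W ≡ C
          drop (inj₁ refl) ne = ⊥-elim (ne refl)
          drop (inj₂ p) ne = p

  In3-cover : {A B C X Y Z : Fin n} → X ≢ Y → X ≢ Z → Y ≢ Z →
              In3 X A B C → In3 Y A B C → In3 Z A B C → ∀ {v} → In3 v A B C → In3 v X Y Z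
  In3-cover xy xz yz hX hY hZ (inj₁ refl) = In3-cover-first xy xz yz hX hY hZ
  In3-cover xy xz yz hX hY hZ (inj₂ (inj₁ refl)) =
    In3-cover-first xy xz yz (In3-rotate hX) (In3-rotate hY) (In3-rotate hZ)
  In3-cover xy xz yz hX hY hZ (inj₂ (inj₂ refl)) =
    In3-cover-first xy xz yz (In3-rotate (In3-rotate hX)) (In3-rotate (In3-rotate hY))
      (In3-rotate (In3-rotate hZ))

record Neighbours {V : Set} (K : Graph V) (u A B C : V) : Set where
  field
    eA : K u A ≡ true
    eB : K u B ≡ true
    eC : K u C ≡ true
    only : ∀ v → K u v ≡ true → In3 v A B C

module _ {V : Set} {K : Graph V} where
  nbrs-adj : {u A B C v : V} → Neighbours K u A B C → In3 v A B C → K u v ≡ true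
  nbrs-adj N (inj₁ refl) = Neighbours.eA N
  nbrs-adj N (inj₂ (inj₁ refl)) = Neighbours.eB N
  nbrs-adj N (inj₂ (inj₂ refl)) = Neighbours.eC N

  nbrs-rotate : {u A B C : V} → Neighbours K u A B C → Neighbours K u B C A
  nbrs-rotate N = record { eA = eB ; eB = eC ; eC = eA ; only = λ v e → In3-rotate (only v e) }
    where open Neighbours N

  nbrs-swap : {u A B C : V} → Neighbours K u A B C → Neighbours K u B A C
  nbrs-swap N = record { eA = eB ; eB = eA ; eC = eC ; only = λ v e → In3-swap (only v e) }
    where open Neighbours N

  nbrs-reverse : {u A B C : V} → Neighbours K u A B C → Neighbours K u C B A
  nbrs-reverse N = nbrs-swap (nbrs-rotate N)

  nbrs-cong : {u A B C A' B' C' : V} → A ≡ A' → B ≡ B' → C ≡ C' →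
              Neighbours K u A B C → Neighbours K u A' B' C'
  nbrs-cong refl refl refl N = N

  nbrs-subst : {u u' A B C : V} → u ≡ u' → Neighbours K u A B C → Neighbours K u' A B C
  nbrs-subst refl N = N

adj-from-nbrs : {V W : Set} {K1 : Graph V} {K2 : Graph W} (f : V → W) → (∀ {x y} → f x ≡ f y → x ≡ y) →
                ∀ {x A B C} → Neighbours K1 x A B C → Neighbours K2 (f x) (f A) (f B) (f C) →
                ∀ y → K2 (f x) (f y) ≡ K1 x y
adj-from-nbrs f inj N1 N2 y = bool-ext _ _
  (λ e → nbrs-adj N1 (In3-reflect f inj (Neighbours.only N2 (f y) e)))
  (λ e → nbrs-adj N2 (In3-map f (Neighbours.only N1 y e)))

module _ {n : ℕ} where
  sameEdgeᵇ-sound : ∀ {u v x y : Fin n} → sameEdgeᵇ u v x y ≡ true → SameEdge u v x y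
  sameEdgeᵇ-sound {u} {v} {x} {y} e with ∨-true {⌊ u ≟ x ⌋ ∧ ⌊ v ≟ y ⌋} e
  ... | inj₁ e' = inj₁ (≟-true (∧-trueˡ e') , ≟-true (∧-trueʳ {⌊ u ≟ x ⌋} e'))
  ... | inj₂ e' = inj₂ (≟-true (∧-trueˡ e') , ≟-true (∧-trueʳ {⌊ u ≟ y ⌋} e'))

  sameEdgeᵇ-complete : ∀ {u v x y : Fin n} → SameEdge u v x y → sameEdgeᵇ u v x y ≡ true
  sameEdgeᵇ-complete {u} {v} (inj₁ (refl , refl)) rewrite ≟-refl u | ≟-refl v = refl
  sameEdgeᵇ-complete {u} {v} (inj₂ (refl , refl)) rewrite ≟-refl u | ≟-refl v = BP.∨-zeroʳ _

  sameEdgeᵇ-false : ∀ {u v x y : Fin n} → ¬ SameEdge u v x y → sameEdgeᵇ u v x y ≡ false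
  sameEdgeᵇ-false {u} {v} {x} {y} ne with sameEdgeᵇ u v x y in eq
  ... | true = ⊥-elim (ne (sameEdgeᵇ-sound eq))
  ... | false = refl

  ¬SameEdge : ∀ {u v x y : Fin n} → (u ≢ x ⊎ v ≢ y) → (u ≢ y ⊎ v ≢ x) → ¬ SameEdge u v x y
  ¬SameEdge (inj₁ a) _ (inj₁ (p , _)) = a p
  ¬SameEdge (inj₂ a) _ (inj₁ (_ , p)) = a p
  ¬SameEdge _ (inj₁ a) (inj₂ (p , _)) = a p
  ¬SameEdge _ (inj₂ a) (inj₂ (_ , p)) = a p

  isOneOf-sound : ∀ {v a b : Fin n} → isOneOf v a b ≡ true → v ≡ a ⊎ v ≡ b
  isOneOf-sound {v} {a} {b} e with ∨-true {⌊ v ≟ a ⌋} e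
  ... | inj₁ e' = inj₁ (≟-true e')
  ... | inj₂ e' = inj₂ (≟-true e')

  isOneOf-complete : ∀ {v a b : Fin n} → v ≡ a ⊎ v ≡ b → isOneOf v a b ≡ true
  isOneOf-complete {v} (inj₁ refl) rewrite ≟-refl v = refl
  isOneOf-complete {v} {a} (inj₂ refl) rewrite ≟-refl v = BP.∨-zeroʳ _

  isOneOf-swap : ∀ (v a b : Fin n) → isOneOf v a b ≡ isOneOf v b a
  isOneOf-swap v a b = BP.∨-comm ⌊ v ≟ a ⌋ ⌊ v ≟ b ⌋

  sameEdgeᵇ-swap : ∀ (u v a b : Fin n) → sameEdgeᵇ u v a b ≡ sameEdgeᵇ u v b a
  sameEdgeᵇ-swap u v a b = BP.∨-comm (⌊ u ≟ a ⌋ ∧ ⌊ v ≟ b ⌋) _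


Linked : {V : Set} → Graph V → V → V → V → V → Set
Linked G A A' B B' = (Edge G A B × Edge G A' B') ⊎ (Edge G A B' × Edge G A' B)

module _ {V : Set} {G : Graph V} where
  FourCycle-rotate : ∀ {w0 w1 w2 w3} → FourCycle G w0 w1 w2 w3 → FourCycle G w1 w2 w3 w0
  FourCycle-rotate (d01 , d02 , d03 , d12 , d13 , d23 , e01 , e12 , e23 , e30) =
    d12 , d13 , ≢-sym d01 , d23 , ≢-sym d02 , ≢-sym d03 , e12 , e23 , e30 , e01

  EdgeOfFourCycle-rotate : ∀ {u v w0 w1 w2 w3 : V} →
    EdgeOfFourCycle u v w0 w1 w2 w3 → EdgeOfFourCycle u v w1 w2 w3 w0
  EdgeOfFourCycle-rotate (inj₁ e) = inj₂ (inj₂ (inj₂ e))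
  EdgeOfFourCycle-rotate (inj₂ (inj₁ e)) = inj₁ e
  EdgeOfFourCycle-rotate (inj₂ (inj₂ (inj₁ e))) = inj₂ (inj₁ e)
  EdgeOfFourCycle-rotate (inj₂ (inj₂ (inj₂ e))) = inj₂ (inj₂ (inj₁ e))

  Linked-swap : ∀ {A A' B B'} → Linked G A A' B B' → Linked G A' A B B'
  Linked-swap (inj₁ (e , e')) = inj₂ (e' , e)
  Linked-swap (inj₂ (e , e')) = inj₁ (e' , e)

  module _ (adj-sym : ∀ {u v} → Edge G u v → Edge G v u) where
    private
      linked-at-w0w1 : ∀ {w0 w1 w2 w3 B B'} → FourCycle G w0 w1 w2 w3 → EdgeOfFourCycle B B' w0 w1 w2 w3 →
                       w0 ≢ B → w0 ≢ B' → w1 ≢ B → w1 ≢ B' → Linked G w0 w1 B B'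
      linked-at-w0w1 _ (inj₁ (inj₁ (refl , _))) n _ _ _ = ⊥-elim (n refl)
      linked-at-w0w1 _ (inj₁ (inj₂ (refl , _))) _ _ n _ = ⊥-elim (n refl)
      linked-at-w0w1 _ (inj₂ (inj₁ (inj₁ (refl , _)))) _ _ n _ = ⊥-elim (n refl)
      linked-at-w0w1 _ (inj₂ (inj₁ (inj₂ (_ , refl)))) _ _ _ n = ⊥-elim (n refl)
      linked-at-w0w1 (_ , _ , _ , _ , _ , _ , _ , e12 , _ , e30) (inj₂ (inj₂ (inj₁ (inj₁ (refl , refl))))) _ _ _ _ =
        inj₂ (adj-sym e30 , e12)
      linked-at-w0w1 (_ , _ , _ , _ , _ , _ , _ , e12 , _ , e30) (inj₂ (inj₂ (inj₁ (inj₂ (refl , refl))))) _ _ _ _ =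
        inj₁ (adj-sym e30 , e12)
      linked-at-w0w1 _ (inj₂ (inj₂ (inj₂ (inj₁ (_ , refl))))) _ n _ _ = ⊥-elim (n refl)
      linked-at-w0w1 _ (inj₂ (inj₂ (inj₂ (inj₂ (refl , _))))) n _ _ _ = ⊥-elim (n refl)

      linked-at-first : ∀ {w0 w1 w2 w3 A A' B B'} → FourCycle G w0 w1 w2 w3 → SameEdge A A' w0 w1 →
                        EdgeOfFourCycle B B' w0 w1 w2 w3 →
                        A ≢ B → A ≢ B' → A' ≢ B → A' ≢ B' → Linked G A A' B B'
      linked-at-first fc (inj₁ (refl , refl)) eB ab ab' a'b a'b' = linked-at-w0w1 fc eB ab ab' a'b a'b'
      linked-at-first fc (inj₂ (refl , refl)) eB ab ab' a'b a'b' =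
        Linked-swap (linked-at-w0w1 fc eB a'b a'b' ab ab')

    square-linked : ∀ {w0 w1 w2 w3 A A' B B'} → FourCycle G w0 w1 w2 w3 →
                    EdgeOfFourCycle A A' w0 w1 w2 w3 → EdgeOfFourCycle B B' w0 w1 w2 w3 →
                    A ≢ B → A ≢ B' → A' ≢ B → A' ≢ B' → Linked G A A' B B'
    square-linked fc (inj₁ eA) eB = linked-at-first fc eA eB
    square-linked fc (inj₂ (inj₁ eA)) eB = linked-at-first (FourCycle-rotate fc) eA (EdgeOfFourCycle-rotate eB)
    square-linked fc (inj₂ (inj₂ (inj₁ eA))) eB =
      linked-at-first (FourCycle-rotate (FourCycle-rotate fc)) eA
        (EdgeOfFourCycle-rotate (EdgeOfFourCycle-rotate eB))
    square-linked fc (inj₂ (inj₂ (inj₂ eA))) eB =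
      linked-at-first (FourCycle-rotate (FourCycle-rotate (FourCycle-rotate fc))) eA
        (EdgeOfFourCycle-rotate (EdgeOfFourCycle-rotate (EdgeOfFourCycle-rotate eB)))

module Simple {V : Set} {H : Graph V} (simp : IsSimple H) where
  adj-sym : ∀ {u v} → H u v ≡ true → H v u ≡ true
  adj-sym {u} {v} e = trans (IsSimple.symmetric simp v u) e

  adj⇒≢ : ∀ {u v} → H u v ≡ true → u ≢ v
  adj⇒≢ {u} e refl = false≢true (trans (sym (IsSimple.loopless simp u)) e)

  spread12-from-¬linked : ∀ {a b c d} → SpreadAtLeast11 H a b c d → ¬ Linked H a b c d →
                          SpreadAtLeast12 H a b c d
  spread12-from-¬linked sp@(ac , ad , bc , bd) ¬linked =
    sp , λ (_ , _ , _ , _ , fc , eab , ecd) → ¬linked (square-linked adj-sym fc eab ecd ac ad bc bd)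

  linked-or-spread12 : ∀ {a b c d} → SpreadAtLeast11 H a b c d →
                       Linked H a b c d ⊎ SpreadAtLeast12 H a b c d
  linked-or-spread12 {a} {b} {c} {d} sp with H a c ∧ H b d in p | H a d ∧ H b c in q
  ... | true | _ = inj₁ (inj₁ (∧-trueˡ p , ∧-trueʳ {H a c} p))
  ... | false | true = inj₁ (inj₂ (∧-trueˡ q , ∧-trueʳ {H a d} q))
  ... | false | false = inj₂ (spread12-from-¬linked sp λ where
    (inj₁ (e , e')) → false≢true (trans (sym p) (cong₂ _∧_ e e'))
    (inj₂ (e , e')) → false≢true (trans (sym q) (cong₂ _∧_ e e')))

module CubicFacts {n : ℕ} (H : Graph (Fin n)) (simp : IsSimple H) (cub : Cubic H) (tf : TriangleFree H) where

  open Simple simp public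

  record Nbrs3 (u : Fin n) : Set where
    field
      l1 l2 l3 : Fin n
      d12 : l1 ≢ l2
      d13 : l1 ≢ l3
      d23 : l2 ≢ l3
      N : Neighbours H u l1 l2 l3

  private
    ≡true⇒T : ∀ {b} → b ≡ true → T b
    ≡true⇒T refl = _

    fromList : (u : Fin n) (L : List (Fin n)) → length L ≡ 3 → Unique L →
               (∀ v → v ∈ L → H u v ≡ true) → (∀ v → H u v ≡ true → v ∈ L) → Nbrs3 u
    fromList u (a ∷ b ∷ c ∷ []) refl ((ab ∷ ac ∷ []) ∷ (bc ∷ []) ∷ [] ∷ []) inL toL =
      record { l1 = a ; l2 = b ; l3 = c ; d12 = ab ; d13 = ac ; d23 = bc
             ; N = record { eA = inL a (here refl) ; eB = inL b (there (here refl))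
                          ; eC = inL c (there (there (here refl)))
                          ; only = λ v e → ∈⇒In3 (toL v e) } }
      where ∈⇒In3 : ∀ {v} → v ∈ (a ∷ b ∷ c ∷ []) → In3 v a b c
            ∈⇒In3 (here p) = inj₁ p
            ∈⇒In3 (there (here p)) = inj₂ (inj₁ p)
            ∈⇒In3 (there (there (here p))) = inj₂ (inj₂ p)

  nbrs-of : ∀ u → Nbrs3 u
  nbrs-of u = fromList u (filterᵇ (H u) (allFin n)) (cub u)
    (UP.filter⁺ (λ v → T? (H u v)) (UP.allFin⁺ n))
    (λ v m → T⇒≡true (proj₂ (∈-filter⁻ (λ v → T? (H u v)) {xs = allFin n} m)))
    (λ v e → ∈-filter⁺ (λ v → T? (H u v)) (∈-allFin v) (≡true⇒T e))

  nbrs-from-distinct : ∀ {u X Y Z} → X ≢ Y → X ≢ Z → Y ≢ Z →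
                       H u X ≡ true → H u Y ≡ true → H u Z ≡ true → Neighbours H u X Y Z
  nbrs-from-distinct {u} {X} {Y} {Z} xy xz yz eX eY eZ = record { eA = eX ; eB = eY ; eC = eZ
    ; only = λ v e → In3-cover xy xz yz (only X eX) (only Y eY) (only Z eZ) (only v e) }
    where open Neighbours (Nbrs3.N (nbrs-of u))

  thirdOf : (A B C p r : Fin n) → Fin n
  thirdOf A B C p r = if not (isOneOf A p r) then A else (if not (isOneOf B p r) then B else C)

  -- the neighbour of u other than p and r; junk unless p, r are distinct neighbours of u
  third : Fin n → Fin n → Fin n → Fin n
  third u p r = thirdOf (Nbrs3.l1 (nbrs-of u)) (Nbrs3.l2 (nbrs-of u)) (Nbrs3.l3 (nbrs-of u)) p r

  record ThirdSpec (u p r w : Fin n) : Set where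
    field
      wp : w ≢ p
      wr : w ≢ r
      nbrs : Neighbours H u p r w

  private
    avoids : ∀ {w p r : Fin n} → isOneOf w p r ≡ false → w ≢ p × w ≢ r
    avoids {w} {p} {r} e = (λ w≡p → clash (inj₁ w≡p)) , (λ w≡r → clash (inj₂ w≡r))
      where clash : w ≡ p ⊎ w ≡ r → ⊥
            clash h = false≢true (trans (sym e) (isOneOf-complete {v = w} {a = p} {b = r} h))

    thirdOf-avoids : ∀ {A B C p r : Fin n} → A ≢ B → A ≢ C → B ≢ C →
                     In3 (thirdOf A B C p r) A B C × thirdOf A B C p r ≢ p × thirdOf A B C p r ≢ r
    thirdOf-avoids {A} {B} {C} {p} {r} ab ac bc with isOneOf A p r in eA
    ... | false = inj₁ refl , avoids {A} eA
    ... | true with isOneOf B p r in eB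
    ...   | false = inj₂ (inj₁ refl) , avoids {B} eB
    ...   | true = inj₂ (inj₂ refl) , C≢p , C≢r
      where
      A∈ = isOneOf-sound {v = A} eA
      B∈ = isOneOf-sound {v = B} eB
      C≢p : C ≢ p
      C≢p refl = no-three-in-two ab ac bc A∈ B∈ (inj₁ refl)
      C≢r : C ≢ r
      C≢r refl = no-three-in-two ab ac bc A∈ B∈ (inj₂ refl)

  thirdSpec : ∀ {u p r} → H u p ≡ true → H u r ≡ true → p ≢ r → ThirdSpec u p r (third u p r)
  thirdSpec {u} {p} {r} ep er pr with thirdOf-avoids {p = p} {r = r} d12 d13 d23
    where open Nbrs3 (nbrs-of u)
  ... | w∈ , wp , wr = record { wp = wp ; wr = wr
      ; nbrs = nbrs-from-distinct pr (≢-sym wp) (≢-sym wr) ep er (nbrs-adj N w∈) }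
    where open Nbrs3 (nbrs-of u)

old : {n : ℕ} → Fin n → Fin (suc (suc n))
old v = suc (suc v)

old-injective : {n : ℕ} {x y : Fin n} → old x ≡ old y → x ≡ y
old-injective refl = refl

module _ {n : ℕ} (H : Graph (Fin n)) where
  bridge-swapˡ : (a b c d : Fin n) → bridge H a b c d ≅ bridge H b a c d
  bridge-swapˡ a b c d = mkIso (λ x → x) (λ x → x) (λ _ → refl) (λ _ → refl) same
    where
    same : ∀ u v → bridge H b a c d u v ≡ bridge H a b c d u v
    same zero zero = refl
    same zero (suc zero) = refl
    same zero (suc (suc v)) = isOneOf-swap v b a
    same (suc zero) zero = refl
    same (suc zero) (suc zero) = refl
    same (suc zero) (suc (suc v)) = refl
    same (suc (suc u)) zero = isOneOf-swap u b a
    same (suc (suc u)) (suc zero) = refl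
    same (suc (suc u)) (suc (suc v)) = cong (λ z → H u v ∧ not z ∧ not (sameEdgeᵇ u v c d)) (sameEdgeᵇ-swap u v b a)

  bridge-swapʳ : (a b c d : Fin n) → bridge H a b c d ≅ bridge H a b d c
  bridge-swapʳ a b c d = mkIso (λ x → x) (λ x → x) (λ _ → refl) (λ _ → refl) same
    where
    same : ∀ u v → bridge H a b d c u v ≡ bridge H a b c d u v
    same zero zero = refl
    same zero (suc zero) = refl
    same zero (suc (suc v)) = refl
    same (suc zero) zero = refl
    same (suc zero) (suc zero) = refl
    same (suc zero) (suc (suc v)) = isOneOf-swap v d c
    same (suc (suc u)) zero = refl
    same (suc (suc u)) (suc zero) = isOneOf-swap u d c
    same (suc (suc u)) (suc (suc v)) = cong (λ z → H u v ∧ not (sameEdgeᵇ u v a b) ∧ not z) (sameEdgeᵇ-swap u v d c)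

  bridge-cong : ∀ {a b c d a' b' c' d'} → a ≡ a' → b ≡ b' → c ≡ c' → d ≡ d' →
                bridge H a b c d ≅ bridge H a' b' c' d'
  bridge-cong refl refl refl refl = ≅-refl

module BridgeNbrs {n : ℕ} (H : Graph (Fin n)) (simp : IsSimple H)
  (p q r s : Fin n) (epq : H p q ≡ true) (ers : H r s ≡ true)
  (pr : p ≢ r) (ps : p ≢ s) (qr : q ≢ r) (qs : q ≢ s) where

  K : Graph (Fin (suc (suc n)))
  K = bridge H p q r s

  attach : Fin n → Fin n → Fin (suc (suc n))
  attach w x = if sameEdgeᵇ w x p q then zero else (if sameEdgeᵇ w x r s then suc zero else old x)

  attach-first : ∀ w x → SameEdge w x p q → attach w x ≡ zero
  attach-first w x se rewrite sameEdgeᵇ-complete se = refl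
  attach-second : ∀ w x → ¬ SameEdge w x p q → SameEdge w x r s → attach w x ≡ suc zero
  attach-second w x n1 se rewrite sameEdgeᵇ-false n1 | sameEdgeᵇ-complete se = refl
  attach-old : ∀ w x → ¬ SameEdge w x p q → ¬ SameEdge w x r s → attach w x ≡ old x
  attach-old w x n1 n2 rewrite sameEdgeᵇ-false n1 | sameEdgeᵇ-false n2 = refl

  open Simple simp

  nbrs-x : Neighbours K zero (suc zero) (old p) (old q)
  nbrs-x = record { eA = refl ; eB = isOneOf-complete {v = p} (inj₁ refl) ; eC = isOneOf-complete {v = q} {a = p} (inj₂ refl)
       ; only = λ { zero () ; (suc zero) _ → inj₁ refl
                  ; (suc (suc v)) e → [ (λ x → inj₂ (inj₁ (cong old x))) , (λ x → inj₂ (inj₂ (cong old x))) ] (isOneOf-sound {v = v} {a = p} {b = q} e) } }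

  nbrs-y : Neighbours K (suc zero) zero (old r) (old s)
  nbrs-y = record { eA = refl ; eB = isOneOf-complete {v = r} (inj₁ refl) ; eC = isOneOf-complete {v = s} {a = r} (inj₂ refl)
       ; only = λ { zero _ → inj₁ refl ; (suc zero) ()
                  ; (suc (suc v)) e → [ (λ x → inj₂ (inj₁ (cong old x))) , (λ x → inj₂ (inj₂ (cong old x))) ] (isOneOf-sound {v = v} {a = r} {b = s} e) } }

  attach-adj : ∀ {w x} → H w x ≡ true → K (old w) (attach w x) ≡ true
  attach-adj {w} {x} e with sameEdgeᵇ w x p q in e1
  ... | true with sameEdgeᵇ-sound {u = w} {v = x} {x = p} {y = q} e1
  ...   | inj₁ (refl , _) = isOneOf-complete {v = w} {a = w} {b = q} (inj₁ refl)
  ...   | inj₂ (refl , _) = isOneOf-complete {v = w} {a = p} {b = w} (inj₂ refl)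
  attach-adj {w} {x} e | false with sameEdgeᵇ w x r s in e2
  ... | true with sameEdgeᵇ-sound {u = w} {v = x} {x = r} {y = s} e2
  ...   | inj₁ (refl , _) = isOneOf-complete {v = w} {a = w} {b = s} (inj₁ refl)
  ...   | inj₂ (refl , _) = isOneOf-complete {v = w} {a = r} {b = w} (inj₂ refl)
  attach-adj {w} {x} e | false | false rewrite e | e1 | e2 = refl

  nbrs-old : ∀ {w A B C} → Neighbours H w A B C → Neighbours K (old w) (attach w A) (attach w B) (attach w C)
  nbrs-old {w} {A} {B} {C} N = record { eA = attach-adj eA ; eB = attach-adj eB ; eC = attach-adj eC ; only = onl }
    where
    open Neighbours N
    via : ∀ {x v} → H w x ≡ true → attach w x ≡ v → In3 v (attach w A) (attach w B) (attach w C)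
    via {x} ex refl = In3-map (attach w) (only x ex)
    onl : ∀ v → K (old w) v ≡ true → In3 v (attach w A) (attach w B) (attach w C)
    onl zero e with isOneOf-sound {v = w} {a = p} {b = q} e
    ... | inj₁ refl = via epq (attach-first p q (inj₁ (refl , refl)))
    ... | inj₂ refl = via (adj-sym epq) (attach-first q p (inj₂ (refl , refl)))
    onl (suc zero) e with isOneOf-sound {v = w} {a = r} {b = s} e
    ... | inj₁ refl = via ers (attach-second r s (¬SameEdge (inj₁ (≢-sym pr)) (inj₁ (≢-sym qr))) (inj₁ (refl , refl)))
    ... | inj₂ refl = via (adj-sym ers) (attach-second s r (¬SameEdge (inj₁ (≢-sym ps)) (inj₁ (≢-sym qs))) (inj₂ (refl , refl)))
    onl (suc (suc x)) e with H w x in ex | sameEdgeᵇ w x p q in e1 | sameEdgeᵇ w x r s in e2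
    ... | true | false | false = via ex (attach-old w x (λ se → false≢true (trans (sym e1) (sameEdgeᵇ-complete se))) (λ se → false≢true (trans (sym e2) (sameEdgeᵇ-complete se))))
    ... | true | true | _ = ⊥-elim (false≢true e)
    ... | true | false | true = ⊥-elim (false≢true e)
    ... | false | _ | _ = ⊥-elim (false≢true e)


-- Sliding a bridge along a square

module Slide {n : ℕ} (H : Graph (Fin n)) (simp : IsSimple H) (cub : Cubic H) (tf : TriangleFree H)
  (p q r s : Fin n) (epq : H p q ≡ true) (ers : H r s ≡ true) (epr : H p r ≡ true) (eqs : H q s ≡ true)
  (ps : p ≢ s) (qr : q ≢ r) where

  open CubicFacts H simp cub tf

  q' s' : Fin n
  q' = third q p s
  s' = third s r q

  TQ : ThirdSpec q p s q'
  TQ = thirdSpec (adj-sym epq) eqs ps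
  TS : ThirdSpec s r q s'
  TS = thirdSpec (adj-sym ers) (adj-sym eqs) (≢-sym qr)

  NQ : Neighbours H q p s q'
  NQ = ThirdSpec.nbrs TQ
  NS : Neighbours H s r q s'
  NS = ThirdSpec.nbrs TS

  eqq' : H q q' ≡ true
  eqq' = Neighbours.eC NQ
  ess' : H s s' ≡ true
  ess' = Neighbours.eC NS

  pq : p ≢ q
  pq = adj⇒≢ epq
  rs : r ≢ s
  rs = adj⇒≢ ers
  pr : p ≢ r
  pr = adj⇒≢ epr
  qs : q ≢ s
  qs = adj⇒≢ eqs
  q'p : q' ≢ p
  q'p = ThirdSpec.wp TQ
  q's : q' ≢ s
  q's = ThirdSpec.wr TQ
  s'r : s' ≢ r
  s'r = ThirdSpec.wp TS
  s'q : s' ≢ q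
  s'q = ThirdSpec.wr TS
  qq' : q ≢ q'
  qq' = adj⇒≢ eqq'
  ss' : s ≢ s'
  ss' = adj⇒≢ ess'
  q'r : q' ≢ r
  q'r e = tf q q' p eqq' (subst (λ z → H z p ≡ true) (sym e) (adj-sym epr)) epq
  s'p : s' ≢ p
  s'p e = tf s s' q ess' (subst (λ z → H z q ≡ true) (sym e) epq) eqs
  q's' : q' ≢ s'
  q's' e = tf q q' s eqq' (subst (λ z → H z s ≡ true) (sym e) (adj-sym ess')) (adj-sym eqs)

  ps-nonadj : H p s ≡ true → ⊥
  ps-nonadj e = tf p q s epq eqs (adj-sym e)
  rq-nonadj : H r q ≡ true → ⊥
  rq-nonadj e = tf r q p e (adj-sym epq) epr

  module B1 = BridgeNbrs H simp p q r s epq ers pr ps qr qs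
  module B2 = BridgeNbrs H simp q q' s s' eqq' ess' qs (λ e → s'q (sym e)) q's q's'

  G1 G2 : Graph (Fin (suc (suc n)))
  G1 = bridge H p q r s
  G2 = bridge H q q' s s'

  -- In G1 the subdivision vertex x = zero of pq has neighbours y, p, q, as q has neighbours s, p
  -- and x in G2 (and symmetrically for y = suc zero and s), so exchanging x ↔ q, y ↔ s is an
  -- isomorphism; the triangle-freeness makes the old neighbourhoods fit.
  φ : Fin (suc (suc n)) → Fin (suc (suc n))
  φ zero = old q
  φ (suc zero) = old s
  φ (suc (suc w)) = if ⌊ w ≟ q ⌋ then zero else (if ⌊ w ≟ s ⌋ then suc zero else old w)

  φq : φ (old q) ≡ zero
  φq rewrite ≟-refl q = refl
  φs : φ (old s) ≡ suc zero
  φs rewrite ≟-neq (≢-sym qs) | ≟-refl s = refl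
  φo : ∀ {w} → w ≢ q → w ≢ s → φ (old w) ≡ old w
  φo a b rewrite ≟-neq a | ≟-neq b = refl

  φφ : ∀ x → φ (φ x) ≡ x
  φφ zero = φq
  φφ (suc zero) = φs
  φφ (suc (suc w)) with w ≟ q
  ... | yes refl = refl
  ... | no a with w ≟ s
  ...   | yes refl = refl
  ...   | no b = φo a b

  φinj : ∀ {x y} → φ x ≡ φ y → x ≡ y
  φinj {x} {y} e = trans (sym (φφ x)) (trans (cong φ e) (φφ y))

  φ-attach : ∀ w X → H w X ≡ true → w ≢ q → w ≢ s → φ (B1.attach w X) ≡ B2.attach w X
  φ-attach w X e wq ws with dec w p
  φ-attach w X e wq ws | inj₁ refl with dec X q
  ... | inj₁ refl = trans (cong φ (B1.attach-first p q (inj₁ (refl , refl))))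
                     (sym (B2.attach-old p q (¬SameEdge (inj₁ pq) (inj₁ (≢-sym q'p))) (¬SameEdge (inj₁ ps) (inj₁ (≢-sym s'p)))))
  ... | inj₂ Xq = trans (cong φ (B1.attach-old p X (¬SameEdge (inj₂ Xq) (inj₁ pq)) (¬SameEdge (inj₁ pr) (inj₁ ps))))
                 (trans (φo Xq (λ { refl → ps-nonadj e }))
                   (sym (B2.attach-old p X (¬SameEdge (inj₁ pq) (inj₁ (≢-sym q'p))) (¬SameEdge (inj₁ ps) (inj₁ (≢-sym s'p))))))
  φ-attach w X e wq ws | inj₂ wp with dec w r
  φ-attach w X e wq ws | inj₂ wp | inj₁ refl with dec X s
  ... | inj₁ refl = trans (cong φ (B1.attach-second r s (¬SameEdge (inj₁ (≢-sym pr)) (inj₁ (≢-sym qr))) (inj₁ (refl , refl))))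
                     (sym (B2.attach-old r s (¬SameEdge (inj₁ (≢-sym qr)) (inj₁ (≢-sym q'r))) (¬SameEdge (inj₁ rs) (inj₁ (≢-sym s'r)))))
  ... | inj₂ Xs = trans (cong φ (B1.attach-old r X (¬SameEdge (inj₁ (≢-sym pr)) (inj₁ (≢-sym qr))) (¬SameEdge (inj₂ Xs) (inj₁ rs))))
                 (trans (φo (λ { refl → rq-nonadj e }) Xs)
                   (sym (B2.attach-old r X (¬SameEdge (inj₁ (≢-sym qr)) (inj₁ (≢-sym q'r))) (¬SameEdge (inj₁ rs) (inj₁ (≢-sym s'r))))))
  φ-attach w X e wq ws | inj₂ wp | inj₂ wr =
    trans (cong φ (B1.attach-old w X (¬SameEdge (inj₁ wp) (inj₁ wq)) (¬SameEdge (inj₁ wr) (inj₁ ws)))) (rest X e)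
    where
    rest : ∀ X → H w X ≡ true → φ (old X) ≡ B2.attach w X
    rest X e with dec X q
    ... | inj₁ refl with Neighbours.only NQ w (adj-sym e)
    ...   | inj₁ x = ⊥-elim (wp x)
    ...   | inj₂ (inj₁ x) = ⊥-elim (ws x)
    ...   | inj₂ (inj₂ x) = trans φq (sym (subst (λ z → B2.attach z q ≡ zero) (sym x) (B2.attach-first q' q (inj₂ (refl , refl)))))
    rest X e | inj₂ Xq with dec X s
    ... | inj₁ refl with Neighbours.only NS w (adj-sym e)
    ...   | inj₁ x = ⊥-elim (wr x)
    ...   | inj₂ (inj₁ x) = ⊥-elim (wq x)
    ...   | inj₂ (inj₂ x) = trans φs (sym (subst (λ z → B2.attach z s ≡ suc zero) (sym x) (B2.attach-second s' s (¬SameEdge (inj₁ s'q) (inj₁ (≢-sym q's'))) (inj₂ (refl , refl)))))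
    rest X e | inj₂ Xq | inj₂ Xs = trans (φo Xq Xs) (sym (B2.attach-old w X (¬SameEdge (inj₁ wq) (inj₂ Xq)) (¬SameEdge (inj₁ ws) (inj₂ Xs))))

  slide-nbrs : ∀ u → Σ (Fin (suc (suc n))) λ A → Σ (Fin (suc (suc n))) λ B → Σ (Fin (suc (suc n))) λ C →
             Neighbours G1 u A B C × Neighbours G2 (φ u) (φ A) (φ B) (φ C)
  slide-nbrs zero = _ , _ , _ , B1.nbrs-x ,
    nbrs-swap (nbrs-cong (trans x (sym (φo pq ps)))
      (B2.attach-old q s (¬SameEdge (inj₂ (≢-sym q's)) (inj₁ qq')) (¬SameEdge (inj₁ qs) (inj₁ (≢-sym s'q))))
      (trans (B2.attach-first q q' (inj₁ (refl , refl))) (sym φq))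
      (B2.nbrs-old NQ))
    where
    x : B2.attach q p ≡ old p
    x = B2.attach-old q p (¬SameEdge (inj₂ (≢-sym q'p)) (inj₁ qq')) (¬SameEdge (inj₁ qs) (inj₁ (≢-sym s'q)))
  slide-nbrs (suc zero) = _ , _ , _ , B1.nbrs-y ,
    nbrs-swap (nbrs-cong
      (trans (B2.attach-old s r (¬SameEdge (inj₁ (≢-sym qs)) (inj₁ (≢-sym q's))) (¬SameEdge (inj₂ (≢-sym s'r)) (inj₁ ss'))) (sym (φo (≢-sym qr) (rs))))
      (B2.attach-old s q (¬SameEdge (inj₁ (≢-sym qs)) (inj₁ (≢-sym q's))) (¬SameEdge (inj₂ (≢-sym s'q)) (inj₁ ss')))
      (trans (B2.attach-second s s' (¬SameEdge (inj₁ (≢-sym qs)) (inj₁ (≢-sym q's))) (inj₁ (refl , refl))) (sym φs))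
      (B2.nbrs-old NS))
  slide-nbrs (suc (suc w)) with dec w q
  ... | inj₁ refl = _ , _ , _ , B1.nbrs-old NQ ,
    nbrs-subst (sym φq) (nbrs-swap (nbrs-cong
      (sym (trans (cong φ (B1.attach-old q s (¬SameEdge (inj₁ (≢-sym pq)) (inj₂ (≢-sym ps))) (¬SameEdge (inj₁ qr) (inj₁ qs)))) φs))
      (sym (trans (cong φ (B1.attach-first q p (inj₂ (refl , refl)))) refl))
      (sym (trans (cong φ (B1.attach-old q q' (¬SameEdge (inj₁ (≢-sym pq)) (inj₂ q'p)) (¬SameEdge (inj₁ qr) (inj₁ qs)))) (φo (≢-sym qq') q's)))
      B2.nbrs-x))
  ... | inj₂ wq with dec w s
  ...   | inj₁ refl = _ , _ , _ , B1.nbrs-old NS ,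
    nbrs-subst (sym φs) (nbrs-swap (nbrs-cong
      (sym (trans (cong φ (B1.attach-old s q (¬SameEdge (inj₁ (≢-sym ps)) (inj₁ (≢-sym qs))) (¬SameEdge (inj₁ (≢-sym rs)) (inj₂ qr)))) φq))
      (sym (trans (cong φ (B1.attach-second s r (¬SameEdge (inj₁ (≢-sym ps)) (inj₁ (≢-sym qs))) (inj₂ (refl , refl)))) refl))
      (sym (trans (cong φ (B1.attach-old s s' (¬SameEdge (inj₁ (≢-sym ps)) (inj₁ (≢-sym qs))) (¬SameEdge (inj₁ (≢-sym rs)) (inj₂ s'r)))) (φo s'q (≢-sym ss'))))
      B2.nbrs-y))
  ...   | inj₂ ws = _ , _ , _ , B1.nbrs-old N ,
    nbrs-subst (sym (φo wq ws)) (nbrs-cong (sym (φ-attach w l1 eA wq ws)) (sym (φ-attach w l2 eB wq ws)) (sym (φ-attach w l3 eC wq ws)) (B2.nbrs-old N))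
    where open Nbrs3 (nbrs-of w)
          open Neighbours N

  slide-iso : G1 ≅ G2
  slide-iso = mkIso φ φ φφ φφ λ u v →
    let (A , B , C , N1 , N2) = slide-nbrs u in adj-from-nbrs φ φinj N1 N2 v

-- Walking along the rails

module Rungs {n : ℕ} (H : Graph (Fin n)) (simp : IsSimple H) (cub : Cubic H) (tf : TriangleFree H)
  (P0 P1 R0 R1 : Fin n) where

  open CubicFacts H simp cub tf

  State : Set
  State = (Fin n × Fin n) × (Fin n × Fin n)

  -- rung i = (P i , R i) , (P (1 + i) , R (1 + i)); each rail is continued by the third
  -- neighbour of its last vertex, avoiding its predecessor and its rung partner.
  step : State → State
  step st = proj₂ st , (third (proj₁ (proj₂ st)) (proj₁ (proj₁ st)) (proj₂ (proj₂ st)) ,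
                        third (proj₂ (proj₂ st)) (proj₂ (proj₁ st)) (proj₁ (proj₂ st)))

  rung : ℕ → State
  rung zero = (P0 , R0) , (P1 , R1)
  rung (suc i) = step (rung i)

  P R : ℕ → Fin n
  P i = proj₁ (proj₁ (rung i))
  R i = proj₂ (proj₁ (rung i))

  record Square (i : ℕ) : Set where
    field
      ePP : H (P i) (P (suc i)) ≡ true
      eRR : H (R i) (R (suc i)) ≡ true
      ePR : H (P i) (R i) ≡ true
      ePR' : H (P (suc i)) (R (suc i)) ≡ true
      diag₁ : P i ≢ R (suc i)
      diag₂ : P (suc i) ≢ R i

  module _ {i : ℕ} (I : Square i) where
    open Square I
    thirdP : ThirdSpec (P (suc i)) (P i) (R (suc i)) (P (suc (suc i)))
    thirdP = thirdSpec (adj-sym ePP) ePR' diag₁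
    thirdR : ThirdSpec (R (suc i)) (R i) (P (suc i)) (R (suc (suc i)))
    thirdR = thirdSpec (adj-sym eRR) (adj-sym ePR') (≢-sym diag₂)

    square-next : H (P (suc (suc i))) (R (suc (suc i))) ≡ true → Square (suc i)
    square-next e = record { ePP = Neighbours.eC (ThirdSpec.nbrs thirdP) ; eRR = Neighbours.eC (ThirdSpec.nbrs thirdR)
      ; ePR = ePR' ; ePR' = e ; diag₁ = ≢-sym (ThirdSpec.wr thirdR) ; diag₂ = ThirdSpec.wr thirdP }

    slide-next : bridge H (P i) (P (suc i)) (R i) (R (suc i)) ≅
             bridge H (P (suc i)) (P (suc (suc i))) (R (suc i)) (R (suc (suc i)))
    slide-next = Slide.slide-iso H simp cub tf (P i) (P (suc i)) (R i) (R (suc i)) ePP eRR ePR ePR' diag₁ diag₂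

    spread12-next : H (P (suc (suc i))) (R (suc (suc i))) ≡ false →
               SpreadAtLeast12 H (P (suc i)) (P (suc (suc i))) (R (suc i)) (R (suc (suc i)))
    spread12-next ef = (adj⇒≢ ePR' , ≢-sym (ThirdSpec.wr thirdR) , ThirdSpec.wr thirdP , d4) , no4
      where
      eP : H (P (suc i)) (P (suc (suc i))) ≡ true
      eP = Neighbours.eC (ThirdSpec.nbrs thirdP)
      eR : H (R (suc i)) (R (suc (suc i))) ≡ true
      eR = Neighbours.eC (ThirdSpec.nbrs thirdR)
      d4 : P (suc (suc i)) ≢ R (suc (suc i))
      d4 x = tf (P (suc i)) (P (suc (suc i))) (R (suc i)) eP
               (subst (λ z → H z (R (suc i)) ≡ true) (sym x) (adj-sym eR)) (adj-sym ePR')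
      no4 : ¬ (∃[ w0 ] ∃[ w1 ] ∃[ w2 ] ∃[ w3 ] (FourCycle H w0 w1 w2 w3 ×
                 EdgeOfFourCycle (P (suc i)) (P (suc (suc i))) w0 w1 w2 w3 ×
                 EdgeOfFourCycle (R (suc i)) (R (suc (suc i))) w0 w1 w2 w3))
      no4 (w0 , w1 , w2 , w3 , fc , x , y) with square-linked adj-sym fc x y (adj⇒≢ ePR') (≢-sym (ThirdSpec.wr thirdR)) (ThirdSpec.wr thirdP) d4
      ... | inj₁ (_ , e) = false≢true (trans (sym ef) e)
      ... | inj₂ (e , _) = tf (P (suc i)) (R (suc i)) (R (suc (suc i))) ePR' eR (adj-sym e)

  Outcome : Graph (Fin (suc (suc n))) → Set
  Outcome G = (∃[ k ] (4 ≤ k × H ≅ Ladder k × G ≅ Ladder (suc k)))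
          ⊎ (∃[ k ] (4 ≤ k × H ≅ Mobius k × G ≅ Mobius (suc k)))
          ⊎ (∃[ a' ] ∃[ b' ] ∃[ c' ] ∃[ d' ]
               (Edge H a' b' × Edge H c' d' × SpreadAtLeast12 H a' b' c' d' ×
                G ≅ bridge H a' b' c' d'))

  bridgeAt : ℕ → Graph (Fin (suc (suc n)))
  bridgeAt i = bridge H (P i) (P (suc i)) (R i) (R (suc i))

  SquaresUpTo : ℕ → Set
  SquaresUpTo k = ∀ i → i ≤ k → Square i

  module Iterate (G : Graph (Fin (suc (suc n)))) (g0 : G ≅ bridgeAt 0) (inv0 : Square 0) where
    ≅bridgeAt : ∀ k → (∀ i → i < k → Square i) → G ≅ bridgeAt k
    ≅bridgeAt zero _ = g0
    ≅bridgeAt (suc k) all = ≅-trans (≅bridgeAt k (λ i i<k → all i (NP.m<n⇒m<1+n i<k))) (slide-next (all k NP.≤-refl))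

    iterate : ∀ k → Outcome G ⊎ SquaresUpTo k
    iterate zero = inj₂ λ { zero _ → inv0 }
    iterate (suc k) with iterate k
    ... | inj₁ res = inj₁ res
    ... | inj₂ all with H (P (suc (suc k))) (R (suc (suc k))) in e
    ...   | true = inj₂ λ i i≤ → case i≤ all
      where
      case : ∀ {i} → i ≤ suc k → SquaresUpTo k → Square i
      case {i} i≤ all with NP.m≤n⇒m<n∨m≡n i≤
      ... | inj₁ i<  = all i (NP.≤-pred i<)
      ... | inj₂ refl = square-next (all k NP.≤-refl) e
    ...   | false = inj₁ (inj₂ (inj₂ (_ , _ , _ , _ ,
              Neighbours.eC (ThirdSpec.nbrs (thirdP Ik)) , Neighbours.eC (ThirdSpec.nbrs (thirdR Ik)) ,
              spread12-next Ik e , ≅bridgeAt (suc k) (λ i i< → all i (NP.≤-pred i<)))))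
      where Ik = all k NP.≤-refl

module RepeatFacts {n : ℕ} (H : Graph (Fin n)) (simp : IsSimple H) (cub : Cubic H) (tf : TriangleFree H) where
  open CubicFacts H simp cub tf

  record RungFacts (P R : ℕ → Fin n) (m : ℕ) : Set where
    field
      eP : ∀ {i} → i ≤ m → H (P i) (P (suc i)) ≡ true
      eR : ∀ {i} → i ≤ m → H (R i) (R (suc i)) ≡ true
      ePR : ∀ {i} → i ≤ m → H (P i) (R i) ≡ true
      dPR : ∀ {i} → i ≤ m → P (suc i) ≢ R i
      dRP : ∀ {i} → i ≤ m → R (suc i) ≢ P i
      nP : ∀ {i} → suc i ≤ m → Neighbours H (P (suc i)) (P i) (R (suc i)) (P (suc (suc i)))
      nR : ∀ {i} → suc i ≤ m → Neighbours H (R (suc i)) (R i) (P (suc i)) (R (suc (suc i)))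
      tP1 : ∀ {i} → suc i ≤ m → P (suc (suc i)) ≢ P i
      tP2 : ∀ {i} → suc i ≤ m → P (suc (suc i)) ≢ R (suc i)
      tR1 : ∀ {i} → suc i ≤ m → R (suc (suc i)) ≢ R i
      tR2 : ∀ {i} → suc i ≤ m → R (suc (suc i)) ≢ P (suc i)

  record Distinct (P R : ℕ → Fin n) (m : ℕ) : Set where
    field
      iPP : ∀ {i j} → i < m → j < m → P i ≡ P j → i ≡ j
      iRR : ∀ {i j} → i < m → j < m → R i ≡ R j → i ≡ j
      iPR : ∀ {i j} → i < m → j < m → P i ≢ R j

  RungFacts-swap : ∀ {P R m} → RungFacts P R m → RungFacts R P m
  RungFacts-swap C = record { eP = eR ; eR = eP ; ePR = λ l → adj-sym (ePR l) ; dPR = dRP ; dRP = dPR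
    ; nP = nR ; nR = nP ; tP1 = tR1 ; tP2 = tR2 ; tR1 = tP1 ; tR2 = tP2 }
    where open RungFacts C

  Distinct-swap : ∀ {P R m} → Distinct P R m → Distinct R P m
  Distinct-swap I = record { iPP = iRR ; iRR = iPP ; iPR = λ a b e → iPR b a (sym e) }
    where open Distinct I

  module _ {P R : ℕ → Fin n} where

    -- The first repetition on the rails returns to P 0 or R 0: every later rail vertex already
    -- has its three neighbours on the rails.
    repeat⇒repeat-at-0 : ∀ m → RungFacts P R m → Distinct P R m → ∀ i → i < m → P m ≡ P i ⊎ P m ≡ R i → P m ≡ P 0 ⊎ P m ≡ R 0
    repeat⇒repeat-at-0 m C I zero _ x = x
    repeat⇒repeat-at-0 (suc m') C' I' (suc j) (s≤s sj≤m') x' = go x'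
      where
      m'<m : m' < suc m'
      m'<m = NP.n<1+n m'
      m'≤m : m' ≤ suc m'
      m'≤m = NP.n≤1+n m'
      go : P (suc m') ≡ P (suc j) ⊎ P (suc m') ≡ R (suc j) → P (suc m') ≡ P 0 ⊎ P (suc m') ≡ R 0
      go (inj₁ e) with suc j ℕ.≟ m'
      ... | yes refl = ⊥-elim (adj⇒≢ (RungFacts.eP C' m'≤m) (sym e))
      ... | no ne with Neighbours.only (RungFacts.nP C' (NP.≤-trans sj≤m' m'≤m)) (P m')
                         (subst (λ z → H z (P m') ≡ true) e (adj-sym (RungFacts.eP C' m'≤m)))
      ...   | inj₁ e' = ⊥-elim (NP.<⇒≢ (NP.<-trans (NP.n<1+n j) sj<m') (sym (Distinct.iPP I' m'<m (NP.<-trans (NP.n<1+n j) (s≤s sj≤m')) e')))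
        where sj<m' = NP.≤∧≢⇒< sj≤m' ne
      ...   | inj₂ (inj₁ e') = ⊥-elim (Distinct.iPR I' m'<m (s≤s sj≤m') e')
      ...   | inj₂ (inj₂ e') = ⊥-elim (RungFacts.tP1 C' (subst (λ z → suc (suc j) ≤ suc z) (sym eq) (NP.n≤1+n _))
                                      (subst (λ z → P (suc z) ≡ P (suc j)) eq e))
        where eq = Distinct.iPP I' m'<m (s≤s (NP.≤∧≢⇒< sj≤m' ne)) e'
      go (inj₂ e) with suc j ℕ.≟ m'
      ... | yes refl = ⊥-elim (RungFacts.dPR C' m'≤m e)
      ... | no ne with Neighbours.only (RungFacts.nR C' (NP.≤-trans sj≤m' m'≤m)) (P m')
                         (subst (λ z → H z (P m') ≡ true) e (adj-sym (RungFacts.eP C' m'≤m)))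
      ...   | inj₁ e' = ⊥-elim (Distinct.iPR I' m'<m (NP.<-trans (NP.n<1+n j) (s≤s sj≤m')) e')
      ...   | inj₂ (inj₁ e') = ⊥-elim (ne (sym (Distinct.iPP I' m'<m (s≤s sj≤m') e')))
      ...   | inj₂ (inj₂ e') = ⊥-elim (Distinct.iPR I' m'<m (s≤s (NP.≤∧≢⇒< sj≤m' ne)) e')

    repeat-at-0⇒3≤ : ∀ m → RungFacts P R m → 1 ≤ m → P m ≡ P 0 ⊎ P m ≡ R 0 → 3 ≤ m
    repeat-at-0⇒3≤ (suc zero) C' _ (inj₁ e) = ⊥-elim (adj⇒≢ (RungFacts.eP C' z≤n) (sym e))
    repeat-at-0⇒3≤ (suc zero) C' _ (inj₂ e) = ⊥-elim (RungFacts.dPR C' z≤n e)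
    repeat-at-0⇒3≤ (suc (suc zero)) C' _ (inj₁ e) = ⊥-elim (RungFacts.tP1 C' (s≤s z≤n) e)
    repeat-at-0⇒3≤ (suc (suc zero)) C' _ (inj₂ e) =
      ⊥-elim (tf (P 0) (P 1) (R 0) (RungFacts.eP C' z≤n) (subst (λ z → H (P 1) z ≡ true) e (RungFacts.eP C' (s≤s z≤n))) (adj-sym (RungFacts.ePR C' z≤n)))
    repeat-at-0⇒3≤ (suc (suc (suc k))) _ _ _ = s≤s (s≤s (s≤s z≤n))

    closes-straight : ∀ m → RungFacts P R m → Distinct P R m → 3 ≤ m → P m ≡ P 0 → R m ≡ R 0
    closes-straight (suc m'@(suc k)) C I (s≤s m'≥2) e' = go
      where
      open RungFacts C
      open Distinct I
      m'<m = NP.n<1+n m'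
      m'≤m = NP.n≤1+n m'
      0<m : 0 < suc m'
      0<m = s≤s z≤n
      1<m : 1 < suc m'
      1<m = s≤s (NP.≤-trans (s≤s z≤n) m'≥2)
      2<m : 2 < suc m'
      2<m = s≤s m'≥2
      P0~P[m'] : H (P 0) (P m') ≡ true
      P0~P[m'] = subst (λ z → H z (P m') ≡ true) e' (adj-sym (eP m'≤m))
      nbrs-P0 : Neighbours H (P 0) (P 1) (R 0) (P m')
      nbrs-P0 = nbrs-from-distinct (iPR 1<m 0<m) (λ x → NP.<-irrefl (iPP 1<m m'<m x) m'≥2)
             (λ x → iPR m'<m 0<m (sym x)) (eP z≤n) (ePR z≤n) P0~P[m']
      go : R (suc m') ≡ R 0
      go with Neighbours.only nbrs-P0 (R (suc m')) (subst (λ z → H z (R (suc m')) ≡ true) e' (ePR NP.≤-refl))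
      ... | inj₂ (inj₁ x) = x
      ... | inj₂ (inj₂ x) = ⊥-elim (tR2 {k} (NP.n≤1+n (suc k)) x)
      ... | inj₁ x with Neighbours.only (nP {0} (s≤s z≤n)) (R m')
                         (subst (λ z → H z (R m') ≡ true) x (adj-sym (eR m'≤m)))
      ...   | inj₁ y = ⊥-elim (iPR 0<m m'<m (sym y))
      ...   | inj₂ (inj₁ y) = ⊥-elim (NP.<-irrefl (sym (iRR m'<m 1<m y)) m'≥2)
      ...   | inj₂ (inj₂ y) = ⊥-elim (iPR 2<m m'<m (sym y))

    closes-twisted : ∀ m → RungFacts P R m → Distinct P R m → 3 ≤ m → P m ≡ R 0 → R m ≡ P 0
    closes-twisted (suc m'@(suc k)) C I (s≤s m'≥2) e' = go
      where
      open RungFacts C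
      open Distinct I
      m'<m = NP.n<1+n m'
      m'≤m = NP.n≤1+n m'
      0<m : 0 < suc m'
      0<m = s≤s z≤n
      1<m : 1 < suc m'
      1<m = s≤s (NP.≤-trans (s≤s z≤n) m'≥2)
      2<m : 2 < suc m'
      2<m = s≤s m'≥2
      R0~P[m'] : H (R 0) (P m') ≡ true
      R0~P[m'] = subst (λ z → H z (P m') ≡ true) e' (adj-sym (eP m'≤m))
      nbrs-R0 : Neighbours H (R 0) (R 1) (P 0) (P m')
      nbrs-R0 = nbrs-from-distinct (λ x → iPR 0<m 1<m (sym x)) (λ x → iPR m'<m 1<m (sym x))
             (λ x → NP.<-irrefl (iPP 0<m m'<m x) (NP.≤-trans (s≤s z≤n) m'≥2)) (eR z≤n) (adj-sym (ePR z≤n)) R0~P[m']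
      go : R (suc m') ≡ P 0
      go with Neighbours.only nbrs-R0 (R (suc m')) (subst (λ z → H z (R (suc m')) ≡ true) e' (ePR NP.≤-refl))
      ... | inj₂ (inj₁ x) = x
      ... | inj₂ (inj₂ x) = ⊥-elim (tR2 {k} (NP.n≤1+n (suc k)) x)
      ... | inj₁ x with Neighbours.only (nR {0} (s≤s z≤n)) (R m')
                         (subst (λ z → H z (R m') ≡ true) x (adj-sym (eR m'≤m)))
      ...   | inj₁ y = ⊥-elim (NP.<-irrefl (sym (iRR m'<m 0<m y)) (NP.≤-trans (s≤s z≤n) m'≥2))
      ...   | inj₂ (inj₁ y) = ⊥-elim (iPR 1<m m'<m (sym y))
      ...   | inj₂ (inj₂ y) = ⊥-elim (tR1 {1} (NP.<⇒≤ 2<m) (subst (λ z → R (suc z) ≡ R 1) (iRR m'<m 2<m y) x))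

search-below : (Q : ℕ → Set) → (∀ i → Dec (Q i)) → ∀ m → (Σ ℕ λ i → i < m × Q i) ⊎ (∀ i → i < m → ¬ Q i)
search-below Q d zero = inj₂ λ i ()
search-below Q d (suc m) with search-below Q d m
... | inj₁ (i , i<m , q) = inj₁ (i , NP.m<n⇒m<1+n i<m , q)
... | inj₂ nob with d m
...   | yes q = inj₁ (m , NP.n<1+n m , q)
...   | no nq = inj₂ λ i i< → case (NP.m<1+n⇒m<n∨m≡n i<) nob nq
  where
  case : ∀ {i} → i < m ⊎ i ≡ m → (∀ i → i < m → ¬ Q i) → ¬ Q m → ¬ Q i
  case (inj₁ l) nob _ = nob _ l
  case (inj₂ refl) _ nq = nq

module Closure {n : ℕ} (H : Graph (Fin n)) (simp : IsSimple H) (cub : Cubic H) (tf : TriangleFree H)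
  (P0 P1 R0 R1 : Fin n) where

  open CubicFacts H simp cub tf
  open Rungs H simp cub tf P0 P1 R0 R1
  open RepeatFacts H simp cub tf

  rungFacts : SquaresUpTo n → ∀ m → m ≤ n → RungFacts P R m
  rungFacts all m m≤n = record
    { eP = λ {i} l → Square.ePP (I l)
    ; eR = λ {i} l → Square.eRR (I l)
    ; ePR = λ {i} l → Square.ePR (I l)
    ; dPR = λ {i} l → Square.diag₂ (I l)
    ; dRP = λ {i} l → ≢-sym (Square.diag₁ (I l))
    ; nP = λ {i} l → ThirdSpec.nbrs (thirdP (I (NP.<⇒≤ l)))
    ; nR = λ {i} l → ThirdSpec.nbrs (thirdR (I (NP.<⇒≤ l)))
    ; tP1 = λ {i} l → ThirdSpec.wp (thirdP (I (NP.<⇒≤ l)))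
    ; tP2 = λ {i} l → ThirdSpec.wr (thirdP (I (NP.<⇒≤ l)))
    ; tR1 = λ {i} l → ThirdSpec.wp (thirdR (I (NP.<⇒≤ l)))
    ; tR2 = λ {i} l → ThirdSpec.wr (thirdR (I (NP.<⇒≤ l))) }
    where
    I : ∀ {i} → i ≤ m → Square i
    I {i} l = all i (NP.≤-trans l m≤n)

  HitP HitR : ℕ → ℕ → Set
  HitP m i = P m ≡ P i ⊎ P m ≡ R i
  HitR m i = R m ≡ P i ⊎ R m ≡ R i

  HitP? : ∀ m i → Dec (HitP m i)
  HitP? m i with P m ≟ P i | P m ≟ R i
  ... | yes x | _ = yes (inj₁ x)
  ... | no _ | yes y = yes (inj₂ y)
  ... | no x | no y = no λ { (inj₁ a) → x a ; (inj₂ b) → y b }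
  HitR? : ∀ m i → Dec (HitR m i)
  HitR? m i with R m ≟ P i | R m ≟ R i
  ... | yes x | _ = yes (inj₁ x)
  ... | no _ | yes y = yes (inj₂ y)
  ... | no x | no y = no λ { (inj₁ a) → x a ; (inj₂ b) → y b }

  Distinct⇒≤n : ∀ {m} → Distinct P R m → m ≤ n
  Distinct⇒≤n {m} I = FP.injective⇒≤ {f = λ (i : Fin m) → P (toℕ i)}
    λ {i} {j} e → FP.toℕ-injective (Distinct.iPP I (FP.toℕ<n i) (FP.toℕ<n j) e)

  Distinct-extend : ∀ {m} → Distinct P R m → (∀ i → i < m → ¬ HitP m i) → (∀ i → i < m → ¬ HitR m i) → P m ≢ R m →
           Distinct P R (suc m)
  Distinct-extend {m} I nP nR pr = record { iPP = iPP' ; iRR = iRR' ; iPR = iPR' }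
    where
    open Distinct I
    sp : ∀ {i} → i < suc m → i < m ⊎ i ≡ m
    sp l = NP.m<1+n⇒m<n∨m≡n l
    iPP' : ∀ {i j} → i < suc m → j < suc m → P i ≡ P j → i ≡ j
    iPP' a b e with sp a | sp b
    ... | inj₁ x | inj₁ y = iPP x y e
    ... | inj₁ x | inj₂ refl = ⊥-elim (nP _ x (inj₁ (sym e)))
    ... | inj₂ refl | inj₁ y = ⊥-elim (nP _ y (inj₁ e))
    ... | inj₂ refl | inj₂ refl = refl
    iRR' : ∀ {i j} → i < suc m → j < suc m → R i ≡ R j → i ≡ j
    iRR' a b e with sp a | sp b
    ... | inj₁ x | inj₁ y = iRR x y e
    ... | inj₁ x | inj₂ refl = ⊥-elim (nR _ x (inj₂ (sym e)))
    ... | inj₂ refl | inj₁ y = ⊥-elim (nR _ y (inj₂ e))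
    ... | inj₂ refl | inj₂ refl = refl
    iPR' : ∀ {i j} → i < suc m → j < suc m → P i ≢ R j
    iPR' a b e with sp a | sp b
    ... | inj₁ x | inj₁ y = iPR x y e
    ... | inj₁ x | inj₂ refl = nR _ x (inj₁ (sym e))
    ... | inj₂ refl | inj₁ y = nP _ y (inj₂ e)
    ... | inj₂ refl | inj₂ refl = pr e

  record FirstHit : Set where
    field
      m : ℕ
      inj : Distinct P R m
      m≤n : m ≤ n
      rep : (Σ ℕ λ i → i < m × HitP m i) ⊎ ((∀ i → i < m → ¬ HitP m i) × (Σ ℕ λ i → i < m × HitR m i))

  first-hit : SquaresUpTo n → ∀ f m → Distinct P R m → n ≤ m + f → FirstHit
  first-hit all f m I fuel with search-below (HitP m) (HitP? m) m
  ... | inj₁ x = record { m = m ; inj = I ; m≤n = Distinct⇒≤n I ; rep = inj₁ x }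
  ... | inj₂ noP with search-below (HitR m) (HitR? m) m
  ...   | inj₁ y = record { m = m ; inj = I ; m≤n = Distinct⇒≤n I ; rep = inj₂ (noP , y) }
  ...   | inj₂ noR = cont f fuel
    where
    I' : Distinct P R (suc m)
    I' = Distinct-extend I noP noR (adj⇒≢ (Square.ePR (all m (Distinct⇒≤n I))))
    cont : ∀ f → n ≤ m + f → FirstHit
    cont zero fuel = ⊥-elim (NP.<-irrefl refl (NP.<-≤-trans (Distinct⇒≤n I') (subst (n ≤_) (NP.+-identityʳ m) fuel)))
    cont (suc f) fuel = first-hit all f (suc m) I' (subst (n ≤_) (NP.+-suc m f) fuel)

  Distinct-0 : Distinct P R 0
  Distinct-0 = record { iPP = λ () ; iRR = λ () ; iPR = λ () }

  record Closed : Set where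
    field
      m : ℕ
      inj : Distinct P R m
      m≤n : m ≤ n
      m≥3 : 3 ≤ m
      kind : (P m ≡ P 0 × R m ≡ R 0) ⊎ (P m ≡ R 0 × R m ≡ P 0)

  closure : SquaresUpTo n → Closed
  closure all with first-hit all n 0 Distinct-0 NP.≤-refl
  ... | F = from-hit (FirstHit.rep F)
    where
    open FirstHit F
    C = rungFacts all m m≤n
    from-hit : (Σ ℕ λ i → i < m × HitP m i) ⊎ ((∀ i → i < m → ¬ HitP m i) × (Σ ℕ λ i → i < m × HitR m i)) → Closed
    from-hit (inj₁ (i , i<m , q)) = record { m = m ; inj = inj ; m≤n = m≤n ; m≥3 = m3 ; kind = close-kind x }
      where
      x = repeat⇒repeat-at-0 m C inj i i<m q
      m3 = repeat-at-0⇒3≤ m C (NP.≤-trans (s≤s z≤n) i<m) x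
      close-kind : P m ≡ P 0 ⊎ P m ≡ R 0 → (P m ≡ P 0 × R m ≡ R 0) ⊎ (P m ≡ R 0 × R m ≡ P 0)
      close-kind (inj₁ e) = inj₁ (e , closes-straight m C inj m3 e)
      close-kind (inj₂ e) = inj₂ (e , closes-twisted m C inj m3 e)
    from-hit (inj₂ (noP , i , i<m , q)) = ⊥-elim (close-kind x)
      where
      C' = RungFacts-swap C
      I' = Distinct-swap inj
      q' : R m ≡ R i ⊎ R m ≡ P i
      q' = [ inj₂ , inj₁ ] q
      x = repeat⇒repeat-at-0 {P = R} {R = P} m C' I' i i<m q'
      m3 = repeat-at-0⇒3≤ {P = R} {R = P} m C' (NP.≤-trans (s≤s z≤n) i<m) x
      0<m : 0 < m
      0<m = NP.≤-<-trans z≤n i<m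
      close-kind : R m ≡ R 0 ⊎ R m ≡ P 0 → ⊥
      close-kind (inj₁ e) = noP 0 0<m (inj₁ (closes-straight {P = R} {R = P} m C' I' m3 e))
      close-kind (inj₂ e) = noP 0 0<m (inj₂ (closes-twisted {P = R} {R = P} m C' I' m3 e))

-- Cyclic arithmetic, ladders and Möbius ladders

≡ᵇ⇒≡ : ∀ x y → (x ≡ᵇ y) ≡ true → x ≡ y
≡ᵇ⇒≡ x y e = NP.≡ᵇ⇒≡ x y (subst T (sym e) tt)

≡⇒≡ᵇ : ∀ x y → x ≡ y → (x ≡ᵇ y) ≡ true
≡⇒≡ᵇ x y e = T⇒≡true (NP.≡⇒≡ᵇ x y e)

≢⇒≡ᵇ-false : ∀ x y → x ≢ y → (x ≡ᵇ y) ≡ false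
≢⇒≡ᵇ-false x y ne with x ≡ᵇ y in e
... | true = ⊥-elim (ne (≡ᵇ⇒≡ x y e))
... | false = refl

<⇒<ᵇ : ∀ x y → x < y → (x <ᵇ y) ≡ true
<⇒<ᵇ x y l = T⇒≡true (NP.<⇒<ᵇ l)

≥⇒<ᵇ-false : ∀ x y → y ≤ x → (x <ᵇ y) ≡ false
≥⇒<ᵇ-false x y le with x <ᵇ y in e
... | true = ⊥-elim (NP.<⇒≱ (NP.<ᵇ⇒< x y (subst T (sym e) tt)) le)
... | false = refl

∨-introʳ : ∀ a b → b ≡ true → a ∨ b ≡ true
∨-introʳ a b refl = BP.∨-zeroʳ a

next : ℕ → ℕ → ℕ
next m a = if suc a ≡ᵇ m then 0 else suc a

prev : ℕ → ℕ → ℕ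
prev m zero = m ∸ 1
prev m (suc a) = a

opposite : ℕ → ℕ → ℕ
opposite k a = if a <ᵇ k then a + k else a ∸ k

next-wrap : ∀ {m a} → suc a ≡ m → next m a ≡ 0
next-wrap {m} {a} e rewrite ≡⇒≡ᵇ (suc a) m e = refl

next-step : ∀ {m a} → suc a ≢ m → next m a ≡ suc a
next-step {m} {a} ne rewrite ≢⇒≡ᵇ-false (suc a) m ne = refl

next< : ∀ {m a} → a < m → next m a < m
next< {m} {a} a<m with suc a ℕ.≟ m
... | yes e rewrite next-wrap e = NP.≤-trans (s≤s z≤n) a<m
... | no ne rewrite next-step ne = NP.≤∧≢⇒< a<m ne

prev< : ∀ {m a} → a < m → prev m a < m
prev< {suc m} {zero} _ = NP.n<1+n m
prev< {m} {suc a} a<m = NP.<-trans (NP.n<1+n a) a<m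

2*≡+ : ∀ k → 2 * k ≡ k + k
2*≡+ k = cong (k +_) (NP.+-identityʳ k)

opposite-low : ∀ {k a} → a < k → opposite k a ≡ a + k
opposite-low {k} {a} l rewrite <⇒<ᵇ a k l = refl

opposite-high : ∀ {k a} → k ≤ a → opposite k a ≡ a ∸ k
opposite-high {k} {a} l rewrite ≥⇒<ᵇ-false a k l = refl

opposite< : ∀ {k a} → a < 2 * k → opposite k a < 2 * k
opposite< {k} {a} l with a ℕ.<? k
... | yes a<k rewrite opposite-low a<k | 2*≡+ k = NP.+-monoˡ-< k a<k
... | no a≮k rewrite opposite-high (NP.≮⇒≥ a≮k) | 2*≡+ k = NP.≤-<-trans (NP.m∸n≤m a k) l

cycAdjℕ⇒ : ∀ {m a b} → a < m → b < m →
  ((suc a ≡ᵇ b) ∨ (suc b ≡ᵇ a) ∨ ((a ≡ᵇ 0) ∧ (suc b ≡ᵇ m)) ∨ ((b ≡ᵇ 0) ∧ (suc a ≡ᵇ m))) ≡ true →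
  b ≡ next m a ⊎ b ≡ prev m a
cycAdjℕ⇒ {m} {a} {b} a<m b<m e with ∨-true {suc a ≡ᵇ b} e
... | inj₁ e1 with ≡ᵇ⇒≡ (suc a) b e1
... | refl = inj₁ (sym (next-step λ x → NP.<-irrefl x b<m))
cycAdjℕ⇒ {m} {a} {b} a<m b<m e | inj₂ e' with ∨-true {suc b ≡ᵇ a} e'
... | inj₁ e2 with ≡ᵇ⇒≡ (suc b) a e2
... | refl = inj₂ refl
cycAdjℕ⇒ {m} {a} {b} a<m b<m e | inj₂ e' | inj₂ e'' with ∨-true {(a ≡ᵇ 0) ∧ (suc b ≡ᵇ m)} e''
... | inj₁ e3 with ≡ᵇ⇒≡ a 0 (∧-trueˡ e3) | ≡ᵇ⇒≡ (suc b) m (∧-trueʳ {a ≡ᵇ 0} e3)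
... | refl | refl = inj₂ refl
cycAdjℕ⇒ {m} {a} {b} a<m b<m e | inj₂ e' | inj₂ e'' | inj₂ e4 with ≡ᵇ⇒≡ b 0 (∧-trueˡ e4) | ≡ᵇ⇒≡ (suc a) m (∧-trueʳ {b ≡ᵇ 0} e4)
... | refl | refl = inj₁ (sym (next-wrap refl))

cycAdjℕ⇐ : ∀ {m a b} → a < m → b < m → b ≡ next m a ⊎ b ≡ prev m a →
  ((suc a ≡ᵇ b) ∨ (suc b ≡ᵇ a) ∨ ((a ≡ᵇ 0) ∧ (suc b ≡ᵇ m)) ∨ ((b ≡ᵇ 0) ∧ (suc a ≡ᵇ m))) ≡ true
cycAdjℕ⇐ {m} {a} {b} a<m b<m (inj₁ refl) with suc a ℕ.≟ m
... | yes e rewrite next-wrap e | ≡⇒≡ᵇ (suc a) m e =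
  ∨-introʳ (suc a ≡ᵇ 0) _ (∨-introʳ (1 ≡ᵇ a) _ (∨-introʳ ((a ≡ᵇ 0) ∧ (1 ≡ᵇ m)) _ refl))
... | no ne rewrite next-step ne | ≡⇒≡ᵇ a a refl = refl
cycAdjℕ⇐ {suc m} {zero} {b} a<m b<m (inj₂ refl) rewrite ≡⇒≡ᵇ m m refl =
  ∨-introʳ (1 ≡ᵇ m) _ (∨-introʳ (suc m ≡ᵇ 0) _ refl)
cycAdjℕ⇐ {m} {suc a} {b} a<m b<m (inj₂ refl) rewrite ≡⇒≡ᵇ a a refl = ∨-introʳ (suc (suc a) ≡ᵇ a) _ refl

module _ {m : ℕ} where
  nextF : Fin m → Fin m
  nextF i = fromℕ< (next< (FP.toℕ<n i))
  prevF : Fin m → Fin m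
  prevF i = fromℕ< (prev< (FP.toℕ<n i))

oppositeF : ∀ {k} → Fin (2 * k) → Fin (2 * k)
oppositeF {k} i = fromℕ< (opposite< {k} (FP.toℕ<n i))

toℕ-nextF : ∀ {m} (i : Fin m) → toℕ (nextF i) ≡ next m (toℕ i)
toℕ-nextF i = FP.toℕ-fromℕ< _
toℕ-prevF : ∀ {m} (i : Fin m) → toℕ (prevF i) ≡ prev m (toℕ i)
toℕ-prevF i = FP.toℕ-fromℕ< _
toℕ-oppositeF : ∀ {k} (i : Fin (2 * k)) → toℕ (oppositeF {k} i) ≡ opposite k (toℕ i)
toℕ-oppositeF i = FP.toℕ-fromℕ< _

cycAdj⇒ : ∀ {m} (i j : Fin m) → cycAdj m i j ≡ true → j ≡ nextF i ⊎ j ≡ prevF i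
cycAdj⇒ i j e with cycAdjℕ⇒ (FP.toℕ<n i) (FP.toℕ<n j) e
... | inj₁ x = inj₁ (FP.toℕ-injective (trans x (sym (toℕ-nextF i))))
... | inj₂ x = inj₂ (FP.toℕ-injective (trans x (sym (toℕ-prevF i))))

cycAdj⇐ : ∀ {m} (i j : Fin m) → j ≡ nextF i ⊎ j ≡ prevF i → cycAdj m i j ≡ true
cycAdj⇐ i j (inj₁ refl) = cycAdjℕ⇐ (FP.toℕ<n i) (FP.toℕ<n j) (inj₁ (toℕ-nextF i))
cycAdj⇐ i j (inj₂ refl) = cycAdjℕ⇐ (FP.toℕ<n i) (FP.toℕ<n j) (inj₂ (toℕ-prevF i))

ladderNbrs : ∀ {m} (s : Bool) (i : Fin m) → Neighbours (Ladder m) (s , i) (s , nextF i) (not s , i) (s , prevF i)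
ladderNbrs {m} false i = record
  { eA = trans (BP.∨-identityʳ _) (cycAdj⇐ i _ (inj₁ refl))
  ; eB = ≟-refl i
  ; eC = trans (BP.∨-identityʳ _) (cycAdj⇐ i _ (inj₂ refl))
  ; only = onl }
  where
  onl : ∀ v → Ladder m (false , i) v ≡ true → In3 v (false , nextF i) (true , i) (false , prevF i)
  onl (false , j) e with cycAdj⇒ i j (trans (sym (BP.∨-identityʳ _)) e)
  ... | inj₁ refl = inj₁ refl
  ... | inj₂ refl = inj₂ (inj₂ refl)
  onl (true , j) e with ≟-true {a = i} {b = j} e
  ... | refl = inj₂ (inj₁ refl)
ladderNbrs {m} true i = record
  { eA = trans (BP.∨-identityʳ _) (cycAdj⇐ i _ (inj₁ refl))
  ; eB = ≟-refl i
  ; eC = trans (BP.∨-identityʳ _) (cycAdj⇐ i _ (inj₂ refl))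
  ; only = onl }
  where
  onl : ∀ v → Ladder m (true , i) v ≡ true → In3 v (true , nextF i) (false , i) (true , prevF i)
  onl (true , j) e with cycAdj⇒ i j (trans (sym (BP.∨-identityʳ _)) e)
  ... | inj₁ refl = inj₁ refl
  ... | inj₂ refl = inj₂ (inj₂ refl)
  onl (false , j) e with ≟-true {a = i} {b = j} e
  ... | refl = inj₂ (inj₁ refl)

opposite-adj : ∀ a k b → b ≡ opposite k a → ((a + k ≡ᵇ b) ∨ (b + k ≡ᵇ a)) ≡ true
opposite-adj a k b e with a ℕ.<? k
... | yes a<k rewrite e | opposite-low a<k = cong (_∨ (a + k + k ≡ᵇ a)) (≡⇒≡ᵇ (a + k) (a + k) refl)
... | no a≮k rewrite e | opposite-high (NP.≮⇒≥ a≮k) = ∨-introʳ _ _ (≡⇒≡ᵇ (a ∸ k + k) a (NP.m∸n+n≡m (NP.≮⇒≥ a≮k)))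

mobiusNbrs : ∀ {k} (i : Fin (2 * k)) → Neighbours (Mobius k) i (nextF i) (oppositeF {k} i) (prevF i)
mobiusNbrs {k} i = record
  { eA = ∨-l (cycAdj⇐ i _ (inj₁ refl))
  ; eB = eB'
  ; eC = ∨-l (cycAdj⇐ i _ (inj₂ refl))
  ; only = onl }
  where
  a = toℕ i
  ∨-l : ∀ {x y} → x ≡ true → x ∨ y ≡ true
  ∨-l refl = refl
  eB' : Mobius k i (oppositeF {k} i) ≡ true
  eB' = ∨-introʳ (cycAdj (2 * k) i (oppositeF {k} i)) _ (opposite-adj a k (toℕ (oppositeF {k} i)) (toℕ-oppositeF {k} i))
  onl : ∀ j → Mobius k i j ≡ true → In3 j (nextF i) (oppositeF {k} i) (prevF i)
  onl j e with ∨-true {cycAdj (2 * k) i j} e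
  ... | inj₁ e1 with cycAdj⇒ i j e1
  ...   | inj₁ x = inj₁ x
  ...   | inj₂ x = inj₂ (inj₂ x)
  onl j e | inj₂ e2 with ∨-true {a + k ≡ᵇ toℕ j} e2
  ... | inj₁ e3 = inj₂ (inj₁ (FP.toℕ-injective (trans (sym (≡ᵇ⇒≡ _ _ e3)) (sym (trans (toℕ-oppositeF {k} i) (opposite-low a<k))))))
    where
    a<k : a < k
    a<k = NP.+-cancelʳ-< k a k (subst (a + k <_) (2*≡+ k) (subst (_< 2 * k) (sym (≡ᵇ⇒≡ _ _ e3)) (FP.toℕ<n j)))
  ... | inj₂ e4 = inj₂ (inj₁ (FP.toℕ-injective (sym (trans (toℕ-oppositeF {k} i) (trans (opposite-high k≤a) eq)))))
    where
    bk = ≡ᵇ⇒≡ _ _ e4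
    k≤a : k ≤ a
    k≤a = subst (k ≤_) bk (NP.m≤n+m k (toℕ j))
    eq : a ∸ k ≡ toℕ j
    eq = trans (cong (_∸ k) (sym bk)) (NP.m+n∸n≡m (toℕ j) k)

record LadderStructure {N : ℕ} (K : Graph (Fin N)) (m : ℕ) (P R : ℕ → Fin N) : Set where
  field
    injP : ∀ {a b} → a < m → b < m → P a ≡ P b → a ≡ b
    injR : ∀ {a b} → a < m → b < m → R a ≡ R b → a ≡ b
    injPR : ∀ {a b} → a < m → b < m → P a ≢ R b
    cov : ∀ v → Σ ℕ λ a → a < m × (v ≡ P a ⊎ v ≡ R a)
    nbP : ∀ {a} → a < m → Neighbours K (P a) (P (next m a)) (R a) (P (prev m a))
    nbR : ∀ {a} → a < m → Neighbours K (R a) (R (next m a)) (P a) (R (prev m a))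

record MobiusStructure {N : ℕ} (K : Graph (Fin N)) (k : ℕ) (W : ℕ → Fin N) : Set where
  field
    inj : ∀ {a b} → a < 2 * k → b < 2 * k → W a ≡ W b → a ≡ b
    cov : ∀ v → Σ ℕ λ a → a < 2 * k × v ≡ W a
    nb : ∀ {a} → a < 2 * k → Neighbours K (W a) (W (next (2 * k) a)) (W (opposite k a)) (W (prev (2 * k) a))

fromℕ<-eq : ∀ {m a} (a<m : a < m) (i : Fin m) → a ≡ toℕ i → fromℕ< a<m ≡ i
fromℕ<-eq a<m i e = FP.toℕ-injective (trans (FP.toℕ-fromℕ< a<m) e)

module _ {N : ℕ} {K : Graph (Fin N)} {m : ℕ} {P R : ℕ → Fin N} (L : LadderStructure K m P R) where
  open LadderStructure L

  private
    fromL : Bool × Fin m → Fin N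
    fromL (false , i) = P (toℕ i)
    fromL (true , i) = R (toℕ i)

    toAux : (v : Fin N) → Σ ℕ (λ a → a < m × (v ≡ P a ⊎ v ≡ R a)) → Bool × Fin m
    toAux v (a , a<m , inj₁ _) = false , fromℕ< a<m
    toAux v (a , a<m , inj₂ _) = true , fromℕ< a<m

    toL : Fin N → Bool × Fin m
    toL v = toAux v (cov v)

    from∘to : ∀ v → fromL (toL v) ≡ v
    from∘to v with cov v
    ... | a , a<m , inj₁ e = trans (cong P (FP.toℕ-fromℕ< a<m)) (sym e)
    ... | a , a<m , inj₂ e = trans (cong R (FP.toℕ-fromℕ< a<m)) (sym e)

    to∘from : ∀ x → toL (fromL x) ≡ x
    to∘from (false , i) with cov (P (toℕ i))
    ... | a , a<m , inj₁ e = cong (false ,_) (fromℕ<-eq a<m i (sym (injP (FP.toℕ<n i) a<m e)))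
    ... | a , a<m , inj₂ e = ⊥-elim (injPR (FP.toℕ<n i) a<m e)
    to∘from (true , i) with cov (R (toℕ i))
    ... | a , a<m , inj₁ e = ⊥-elim (injPR a<m (FP.toℕ<n i) (sym e))
    ... | a , a<m , inj₂ e = cong (true ,_) (fromℕ<-eq a<m i (sym (injR (FP.toℕ<n i) a<m e)))

    from-injective : ∀ {x y} → fromL x ≡ fromL y → x ≡ y
    from-injective {x} {y} e = trans (sym (to∘from x)) (trans (cong toL e) (to∘from y))

    nbrs-from : ∀ x → Neighbours K (fromL x) (fromL (proj₁ x , nextF (proj₂ x))) (fromL (not (proj₁ x) , proj₂ x))
                                  (fromL (proj₁ x , prevF (proj₂ x)))
    nbrs-from (false , i) = nbrs-cong (sym (cong P (toℕ-nextF i))) refl (sym (cong P (toℕ-prevF i))) (nbP (FP.toℕ<n i))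
    nbrs-from (true , i) = nbrs-cong (sym (cong R (toℕ-nextF i))) refl (sym (cong R (toℕ-prevF i))) (nbR (FP.toℕ<n i))

  ladderIso : K ≅ Ladder m
  ladderIso = mkIsoFrom toL fromL to∘from from∘to λ x y →
    adj-from-nbrs fromL from-injective (ladderNbrs (proj₁ x) (proj₂ x)) (nbrs-from x) y

module _ {N : ℕ} {K : Graph (Fin N)} {k : ℕ} {W : ℕ → Fin N} (M : MobiusStructure K k W) where
  open MobiusStructure M

  private
    fromM : Fin (2 * k) → Fin N
    fromM i = W (toℕ i)

    toM : Fin N → Fin (2 * k)
    toM v = fromℕ< (proj₁ (proj₂ (cov v)))

    from∘to : ∀ v → fromM (toM v) ≡ v
    from∘to v = trans (cong W (FP.toℕ-fromℕ< _)) (sym (proj₂ (proj₂ (cov v))))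

    to∘from : ∀ x → toM (fromM x) ≡ x
    to∘from x = fromℕ<-eq (proj₁ (proj₂ (cov (W (toℕ x))))) x (sym (inj (FP.toℕ<n x) (proj₁ (proj₂ (cov (W (toℕ x))))) (proj₂ (proj₂ (cov (W (toℕ x)))))))

    from-injective : ∀ {x y} → fromM x ≡ fromM y → x ≡ y
    from-injective {x} {y} e = trans (sym (to∘from x)) (trans (cong toM e) (to∘from y))

    nbrs-from : ∀ i → Neighbours K (fromM i) (fromM (nextF i)) (fromM (oppositeF {k} i)) (fromM (prevF i))
    nbrs-from i = nbrs-cong (sym (cong W (toℕ-nextF i))) (sym (cong W (toℕ-oppositeF {k} i))) (sym (cong W (toℕ-prevF i)))
             (nb (FP.toℕ<n i))

  mobiusIso : K ≅ Mobius k
  mobiusIso = mkIsoFrom toM fromM to∘from from∘to λ x y → adj-from-nbrs fromM from-injective (mobiusNbrs x) (nbrs-from x) y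

-- Bridging the closing rail edges P m' P 0 and R m' R 0 of a ladder with m = 1 + m' rungs gives a
-- ladder with m + 1 rungs, whose new rung x y gets index m.
module BridgeLadder {N : ℕ} (K : Graph (Fin N)) (simp : IsSimple K) (m' : ℕ) (P R : ℕ → Fin N)
  (L : LadderStructure K (suc m') P R) (m'≥2 : 2 ≤ m') where
  open LadderStructure L

  m : ℕ
  m = suc m'

  m'<m : m' < m
  m'<m = NP.n<1+n m'
  0<m : 0 < m
  0<m = s≤s z≤n

  Pne : ∀ {a b} → a < m → b < m → a ≢ b → P a ≢ P b
  Pne a< b< ne e = ne (injP a< b< e)
  Rne : ∀ {a b} → a < m → b < m → a ≢ b → R a ≢ R b
  Rne a< b< ne e = ne (injR a< b< e)
  PR : ∀ {a b} → a < m → b < m → P a ≢ R b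
  PR = injPR
  RP : ∀ {a b} → a < m → b < m → R a ≢ P b
  RP a< b< e = injPR b< a< (sym e)

  next-m'-wraps : next m m' ≡ 0
  next-m'-wraps = next-wrap refl

  epq : K (P m') (P 0) ≡ true
  epq = subst (λ z → K (P m') (P z) ≡ true) next-m'-wraps (Neighbours.eA (nbP m'<m))
  ers : K (R m') (R 0) ≡ true
  ers = subst (λ z → K (R m') (R z) ≡ true) next-m'-wraps (Neighbours.eA (nbR m'<m))

  module B = BridgeNbrs K simp (P m') (P 0) (R m') (R 0) epq ers (PR m'<m m'<m) (PR m'<m 0<m) (PR 0<m m'<m) (PR 0<m 0<m)

  K' : Graph (Fin (suc (suc N)))
  K' = B.K

  P' R' : ℕ → Fin (suc (suc N))
  P' a = if a ≡ᵇ m then zero else old (P a)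
  R' a = if a ≡ᵇ m then suc zero else old (R a)

  P'm : P' m ≡ zero
  P'm rewrite ≡⇒≡ᵇ m m refl = refl
  R'm : R' m ≡ suc zero
  R'm rewrite ≡⇒≡ᵇ m m refl = refl
  P'o : ∀ {a} → a ≢ m → P' a ≡ old (P a)
  P'o {a} ne rewrite ≢⇒≡ᵇ-false a m ne = refl
  R'o : ∀ {a} → a ≢ m → R' a ≡ old (R a)
  R'o {a} ne rewrite ≢⇒≡ᵇ-false a m ne = refl


  lt : ∀ {a} → a < suc m → a ≢ m → a < m
  lt a< ne = NP.≤∧≢⇒< (NP.≤-pred a<) ne

  1≢m' : 1 ≢ m'
  1≢m' e with subst (2 ≤_) (sym e) m'≥2
  ... | s≤s ()

  injP' : ∀ {a b} → a < suc m → b < suc m → P' a ≡ P' b → a ≡ b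
  injP' {a} {b} a< b< e with a ℕ.≟ m | b ℕ.≟ m
  ... | yes refl | yes refl = refl
  ... | yes refl | no nb = ⊥-elim (0≢ss (trans (sym P'm) (trans e (P'o nb))))
    where 0≢ss : ∀ {x : Fin N} → zero ≢ old x
          0≢ss ()
  ... | no na | yes refl = ⊥-elim (0≢ss (trans (sym P'm) (trans (sym e) (P'o na))))
    where 0≢ss : ∀ {x : Fin N} → zero ≢ old x
          0≢ss ()
  ... | no na | no nb = injP (lt a< na) (lt b< nb) (old-injective (trans (sym (P'o na)) (trans e (P'o nb))))

  injR' : ∀ {a b} → a < suc m → b < suc m → R' a ≡ R' b → a ≡ b
  injR' {a} {b} a< b< e with a ℕ.≟ m | b ℕ.≟ m
  ... | yes refl | yes refl = refl
  ... | yes refl | no nb = ⊥-elim (1≢ss (trans (sym R'm) (trans e (R'o nb))))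
    where 1≢ss : ∀ {x : Fin N} → suc zero ≢ old x
          1≢ss ()
  ... | no na | yes refl = ⊥-elim (1≢ss (trans (sym R'm) (trans (sym e) (R'o na))))
    where 1≢ss : ∀ {x : Fin N} → suc zero ≢ old x
          1≢ss ()
  ... | no na | no nb = injR (lt a< na) (lt b< nb) (old-injective (trans (sym (R'o na)) (trans e (R'o nb))))

  injPR' : ∀ {a b} → a < suc m → b < suc m → P' a ≢ R' b
  injPR' {a} {b} a< b< e with a ℕ.≟ m | b ℕ.≟ m
  ... | yes refl | yes refl = 0≢1 (trans (sym P'm) (trans e R'm))
    where 0≢1 : zero ≢ suc {suc N} zero
          0≢1 ()
  ... | yes refl | no nb = 0≢ss (trans (sym P'm) (trans e (R'o nb)))
    where 0≢ss : ∀ {x : Fin N} → zero ≢ old x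
          0≢ss ()
  ... | no na | yes refl = ss≢1 (trans (sym (P'o na)) (trans e R'm))
    where ss≢1 : ∀ {x : Fin N} → old x ≢ suc zero
          ss≢1 ()
  ... | no na | no nb = injPR (lt a< na) (lt b< nb) (old-injective (trans (sym (P'o na)) (trans e (R'o nb))))

  cov' : ∀ v → Σ ℕ λ a → a < suc m × (v ≡ P' a ⊎ v ≡ R' a)
  cov' zero = m , NP.n<1+n m , inj₁ (sym P'm)
  cov' (suc zero) = m , NP.n<1+n m , inj₂ (sym R'm)
  cov' (suc (suc w)) with cov w
  ... | a , a< , inj₁ e = a , NP.m<n⇒m<1+n a< , inj₁ (trans (cong old e) (sym (P'o (NP.<⇒≢ a<))))
  ... | a , a< , inj₂ e = a , NP.m<n⇒m<1+n a< , inj₂ (trans (cong old e) (sym (R'o (NP.<⇒≢ a<))))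

  next-m-wraps : next (suc m) m ≡ 0
  next-m-wraps = next-wrap refl

  not-closingP : ∀ a → a < m → suc a < m → P a ≢ P 0 ⊎ P (suc a) ≢ P m'
  not-closingP zero a<m sa<m = inj₂ (Pne sa<m m'<m 1≢m')
  not-closingP (suc a') a<m sa<m = inj₁ (Pne a<m 0<m (λ ()))
  not-closingR : ∀ a → a < m → suc a < m → R a ≢ R 0 ⊎ R (suc a) ≢ R m'
  not-closingR zero a<m sa<m = inj₂ (Rne sa<m m'<m 1≢m')
  not-closingR (suc a') a<m sa<m = inj₁ (Rne a<m 0<m (λ ()))

  attach-prevP : ∀ a → a < m → B.attach (P a) (P (prev m a)) ≡ P' (prev (suc m) a)
  attach-prevP zero a<m = trans (B.attach-first (P 0) (P m') (inj₂ (refl , refl))) (sym P'm)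
  attach-prevP (suc a') a<m = trans (B.attach-old (P (suc a')) (P a') (¬SameEdge fst (inj₁ (Pne a<m 0<m (λ ()))))
                                 (¬SameEdge (inj₁ (PR a<m m'<m)) (inj₁ (PR a<m 0<m))))
                        (sym (P'o (NP.<⇒≢ a'<m)))
    where
    a'<m : a' < m
    a'<m = NP.<-trans (NP.n<1+n a') a<m
    fst : P (suc a') ≢ P m' ⊎ P a' ≢ P 0
    fst with suc a' ℕ.≟ m'
    ... | yes e = inj₂ (Pne a'<m 0<m (λ e' → 1≢m' (trans (cong suc (sym e')) e)))
    ... | no ne = inj₁ (Pne a<m m'<m ne)


  R-off-closingP : ∀ a → a < m → ∀ x → ¬ SameEdge (R a) x (P m') (P 0)
  R-off-closingP a a<m x = ¬SameEdge (inj₁ (RP a<m m'<m)) (inj₁ (RP a<m 0<m))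

  attach-prevR : ∀ a → a < m → B.attach (R a) (R (prev m a)) ≡ R' (prev (suc m) a)
  attach-prevR zero a<m = trans (B.attach-second (R 0) (R m') (R-off-closingP 0 a<m (R m')) (inj₂ (refl , refl))) (sym R'm)
  attach-prevR (suc a') a<m = trans (B.attach-old (R (suc a')) (R a') (R-off-closingP (suc a') a<m _) (¬SameEdge fst (inj₁ (Rne a<m 0<m (λ ())))))
                        (sym (R'o (NP.<⇒≢ a'<m)))
    where
    a'<m : a' < m
    a'<m = NP.<-trans (NP.n<1+n a') a<m
    fst : R (suc a') ≢ R m' ⊎ R a' ≢ R 0
    fst with suc a' ℕ.≟ m'
    ... | yes e = inj₂ (Rne a'<m 0<m (λ e' → 1≢m' (trans (cong suc (sym e')) e)))
    ... | no ne = inj₁ (Rne a<m m'<m ne)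


  nbP' : ∀ {a} → a < suc m → Neighbours K' (P' a) (P' (next (suc m) a)) (R' a) (P' (prev (suc m) a))
  nbP' {a} a< with a ℕ.≟ m
  ... | yes refl = nbrs-subst (sym P'm) (nbrs-cong
         (sym (trans (cong P' next-m-wraps) (P'o (λ ()))))
         (sym R'm)
         (sym (P'o (NP.<⇒≢ m'<m)))
         (nbrs-rotate (nbrs-rotate B.nbrs-x)))
  ... | no na = nbrs-subst (sym (P'o na)) (nbrs-cong e1 e2 e3 (B.nbrs-old (nbP a<m)))
    where
    a<m = lt a< na
    e2 : B.attach (P a) (R a) ≡ R' a
    e2 = trans (B.attach-old (P a) (R a) (¬SameEdge (inj₂ (RP a<m 0<m)) (inj₂ (RP a<m m'<m)))
                                    (¬SameEdge (inj₁ (PR a<m m'<m)) (inj₁ (PR a<m 0<m))))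
               (sym (R'o na))
    e1 : B.attach (P a) (P (next m a)) ≡ P' (next (suc m) a)
    e1 with suc a ℕ.≟ m
    ... | yes refl = trans (cong (B.attach (P m')) (cong P next-m'-wraps))
                       (trans (B.attach-first (P m') (P 0) (inj₁ (refl , refl)))
                          (sym (trans (cong P' (next-step {m = suc m} (λ e → NP.<⇒≢ a<m (NP.suc-injective e)))) P'm)))
    ... | no ns = trans (cong (B.attach (P a)) (cong P (next-step ns)))
                    (trans (B.attach-old (P a) (P (suc a)) (¬SameEdge (inj₁ (Pne a<m m'<m (λ e → ns (cong suc e)))) sec)
                                     (¬SameEdge (inj₁ (PR a<m m'<m)) (inj₁ (PR a<m 0<m))))
                      (sym (trans (cong P' (next-step {m = suc m} (λ e → NP.<⇒≢ a<m (NP.suc-injective e)))) (P'o ns))))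
      where
      sa<m : suc a < m
      sa<m = NP.≤∧≢⇒< a<m ns
      sec : P a ≢ P 0 ⊎ P (suc a) ≢ P m'
      sec = not-closingP a a<m sa<m
    e3 : B.attach (P a) (P (prev m a)) ≡ P' (prev (suc m) a)
    e3 = attach-prevP a a<m

  nbR' : ∀ {a} → a < suc m → Neighbours K' (R' a) (R' (next (suc m) a)) (P' a) (R' (prev (suc m) a))
  nbR' {a} a< with a ℕ.≟ m
  ... | yes refl = nbrs-subst (sym R'm) (nbrs-cong
         (sym (trans (cong R' next-m-wraps) (R'o (λ ()))))
         (sym P'm)
         (sym (R'o (NP.<⇒≢ m'<m)))
         (nbrs-rotate (nbrs-rotate B.nbrs-y)))
  ... | no na = nbrs-subst (sym (R'o na)) (nbrs-cong e1 e2 e3 (B.nbrs-old (nbR a<m)))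
    where
    a<m = lt a< na
    e2 : B.attach (R a) (P a) ≡ P' a
    e2 = trans (B.attach-old (R a) (P a) (¬SameEdge (inj₁ (RP a<m m'<m)) (inj₁ (RP a<m 0<m)))
                                    (¬SameEdge (inj₂ (PR a<m 0<m)) (inj₂ (PR a<m m'<m))))
               (sym (P'o na))
    nP : ∀ x → ¬ SameEdge (R a) x (P m') (P 0)
    nP x = ¬SameEdge (inj₁ (RP a<m m'<m)) (inj₁ (RP a<m 0<m))
    e1 : B.attach (R a) (R (next m a)) ≡ R' (next (suc m) a)
    e1 with suc a ℕ.≟ m
    ... | yes refl = trans (cong (B.attach (R m')) (cong R next-m'-wraps))
                       (trans (B.attach-second (R m') (R 0) (nP (R 0)) (inj₁ (refl , refl)))
                          (sym (trans (cong R' (next-step {m = suc m} (λ e → NP.<⇒≢ a<m (NP.suc-injective e)))) R'm)))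
    ... | no ns = trans (cong (B.attach (R a)) (cong R (next-step ns)))
                    (trans (B.attach-old (R a) (R (suc a)) (nP _) (¬SameEdge (inj₁ (Rne a<m m'<m (λ e → ns (cong suc e)))) sec))
                      (sym (trans (cong R' (next-step {m = suc m} (λ e → NP.<⇒≢ a<m (NP.suc-injective e)))) (R'o ns))))
      where
      sa<m : suc a < m
      sa<m = NP.≤∧≢⇒< a<m ns
      sec : R a ≢ R 0 ⊎ R (suc a) ≢ R m'
      sec = not-closingR a a<m sa<m
    e3 : B.attach (R a) (R (prev m a)) ≡ R' (prev (suc m) a)
    e3 = attach-prevR a a<m

  bridged-ladder : LadderStructure K' (suc m) P' R'
  bridged-ladder = record { injP = injP' ; injR = injR' ; injPR = injPR' ; cov = cov' ; nbP = nbP' ; nbR = nbR' }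


-- Bridging W m' W m and W (m + m') W 0 in a Möbius ladder on 2m vertices, m = 1 + m': the new
-- vertices x, y get indices m and 2m + 1, and the old W (m + t) gets index m + t + 1.
module BridgeMobius {N : ℕ} (K : Graph (Fin N)) (simp : IsSimple K) (m' : ℕ) (W : ℕ → Fin N)
  (Mb : MobiusStructure K (suc m') W) (m'≥2 : 2 ≤ m') where
  open MobiusStructure Mb

  m M M' : ℕ
  m = suc m'
  M = 2 * m
  M' = 2 * suc m

  Mm : M ≡ m + m
  Mm = 2*≡+ m
  Ms : M ≡ suc (m + m')
  Ms = trans Mm (NP.+-suc m m')
  M'≡ : M' ≡ suc (suc (m + m))
  M'≡ = trans (2*≡+ (suc m)) (cong suc (NP.+-suc m m))

  m'<m : m' < m
  m'<m = NP.n<1+n m'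
  0<m : 0 < m
  0<m = s≤s z≤n
  m≤ : ∀ t → m ≤ m + t
  m≤ t = NP.m≤m+n m t
  loM : ∀ {j} → j < m → j < M
  loM {j} l = subst (j <_) (sym Mm) (NP.<-≤-trans l (m≤ m))
  hiM : ∀ {t} → t < m → m + t < M
  hiM {t} l = subst (m + t <_) (sym Mm) (NP.+-monoʳ-< m l)
  m'≢0 : m' ≢ 0
  m'≢0 e with subst (2 ≤_) e m'≥2
  ... | ()

  Wne : ∀ {a b} → a < M → b < M → a ≢ b → W a ≢ W b
  Wne a< b< ne e = ne (inj a< b< e)

  mM : m < M
  mM = subst (m <_) (sym Mm) (NP.m<m+n m (s≤s z≤n))
  mM' : m < M'
  mM' = subst (m <_) (sym M'≡) (s≤s (NP.m≤n⇒m≤1+n (m≤ m)))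
  scLoM : ∀ {j} → j < m → next M j ≡ suc j
  scLoM l = next-step λ e → NP.<-irrefl refl (NP.≤-<-trans (subst (_≤ m) e l) mM)
  scLoM' : ∀ {j} → j < m → next M' j ≡ suc j
  scLoM' l = next-step λ e → NP.<-irrefl refl (NP.≤-<-trans (subst (_≤ m) e l) mM')

  epq : K (W m') (W m) ≡ true
  epq = subst (λ z → K (W m') (W z) ≡ true) (scLoM m'<m) (Neighbours.eA (nb (loM m'<m)))
  scr : next M (m + m') ≡ 0
  scr = next-wrap (sym Ms)
  ers : K (W (m + m')) (W 0) ≡ true
  ers = subst (λ z → K (W (m + m')) (W z) ≡ true) scr (Neighbours.eA (nb (hiM m'<m)))

  m'<M : m' < M
  m'<M = loM m'<m
  m<M : m < M
  m<M = subst (m <_) (sym Mm) (NP.m<m+n m 0<m)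
  r<M : m + m' < M
  r<M = hiM m'<m
  0<M = loM 0<m

  m'≢m+t : ∀ t → m' ≢ m + t
  m'≢m+t t = NP.<⇒≢ (NP.<-≤-trans m'<m (m≤ t))
  m≢m+m' : m ≢ m + m'
  m≢m+m' e = m'≢0 (sym (NP.+-cancelˡ-≡ m 0 m' (trans (NP.+-identityʳ m) e)))

  module B = BridgeNbrs K simp (W m') (W m) (W (m + m')) (W 0) epq ers
    (Wne m'<M r<M (m'≢m+t m')) (Wne m'<M 0<M m'≢0) (Wne m<M r<M m≢m+m') (Wne m<M 0<M (λ ()))

  K' : Graph (Fin (suc (suc N)))
  K' = B.K

  W' : ℕ → Fin (suc (suc N))
  W' a = if a ℕ.<ᵇ m then old (W a) else
         (if a ≡ᵇ m then zero else (if a ≡ᵇ suc (m + m) then suc zero else old (W (a ∸ 1))))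

  W'lo : ∀ {j} → j < m → W' j ≡ old (W j)
  W'lo {j} l rewrite <⇒<ᵇ j m l = refl
  W'x : W' m ≡ zero
  W'x rewrite ≥⇒<ᵇ-false m m NP.≤-refl | ≡⇒≡ᵇ m m refl = refl
  W'hi : ∀ {t} → t < m → W' (suc (m + t)) ≡ old (W (m + t))
  W'hi {t} l rewrite ≥⇒<ᵇ-false (suc (m + t)) m (NP.m≤n⇒m≤1+n (m≤ t))
                   | ≢⇒≡ᵇ-false (suc (m + t)) m (λ e → NP.<-irrefl (sym e) (s≤s (m≤ t)))
                   | ≢⇒≡ᵇ-false (suc (m + t)) (suc (m + m)) (λ e → NP.<-irrefl (NP.+-cancelˡ-≡ m _ _ (NP.suc-injective e)) l) = refl
  W'y : W' (suc (m + m)) ≡ suc zero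
  W'y rewrite ≥⇒<ᵇ-false (suc (m + m)) m (NP.m≤n⇒m≤1+n (m≤ m))
            | ≢⇒≡ᵇ-false (suc (m + m)) m (λ e → NP.<-irrefl (sym e) (s≤s (m≤ m)))
            | ≡⇒≡ᵇ (suc (m + m)) (suc (m + m)) refl = refl

  prM0 : prev M 0 ≡ m + m'
  prM0 = cong (_∸ 1) Ms
  prM'0 : prev M' 0 ≡ suc (m + m)
  prM'0 = cong (_∸ 1) M'≡

  loFst : ∀ j → j < m → W j ≢ W m' ⊎ W (m + j) ≢ W m
  loFst j l with j ℕ.≟ m'
  ... | yes refl = inj₂ (Wne (hiM l) m<M (λ e → m'≢0 (sym (NP.+-cancelˡ-≡ m 0 m' (trans (NP.+-identityʳ m) (sym e))))))
  ... | no ne = inj₁ (Wne (loM l) m'<M ne)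
  loSnd : ∀ j → j < m → W j ≢ W 0 ⊎ W (m + j) ≢ W (m + m')
  loSnd zero l = inj₂ (Wne (hiM l) r<M (λ e → m'≢0 (sym (NP.+-cancelˡ-≡ m 0 m' e))))
  loSnd (suc j) l = inj₁ (Wne (loM l) 0<M (λ ()))
  hiSnd : ∀ t → t < m → W (m + t) ≢ W m ⊎ W t ≢ W m'
  hiSnd zero l = inj₂ (Wne (loM 0<m) m'<M (λ e → m'≢0 (sym e)))
  hiSnd (suc t') l = inj₁ (Wne (hiM l) m<M (λ e → NP.<-irrefl (sym e) (NP.m<m+n m (s≤s z≤n))))
  hiFst : ∀ t → t < m → W (m + t) ≢ W (m + m') ⊎ W t ≢ W 0
  hiFst t l with t ℕ.≟ m'
  ... | yes refl = inj₂ (Wne (loM l) 0<M m'≢0)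
  ... | no ne = inj₁ (Wne (hiM l) r<M (λ e → ne (NP.+-cancelˡ-≡ m _ _ e)))

  lo-next : ∀ {j} → j < m → B.attach (W j) (W (next M j)) ≡ W' (next M' j)
  lo-next {j} l rewrite scLoM l | scLoM' l with j ℕ.≟ m'
  ... | yes refl = trans (B.attach-first _ _ (inj₁ (refl , refl))) (sym W'x)
  ... | no ne = trans (B.attach-old _ _ (¬SameEdge (inj₁ (Wne jM m'<M ne)) (inj₁ (Wne jM m<M (NP.<⇒≢ l))))
                                        (¬SameEdge (inj₁ (Wne jM r<M (NP.<⇒≢ (NP.<-≤-trans l (m≤ m')))))
                                                   (inj₂ (Wne sjM r<M (NP.<⇒≢ (NP.<-≤-trans sj<m (m≤ m')))))))
                      (sym (W'lo sj<m))
    where jM = loM l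
          sj<m = NP.≤∧≢⇒< l (λ e → ne (NP.suc-injective e))
          sjM = loM sj<m

  lo-opposite : ∀ {j} → j < m → B.attach (W j) (W (opposite m j)) ≡ W' (opposite (suc m) j)
  lo-opposite {j} l rewrite opposite-low l | opposite-low (NP.m<n⇒m<1+n l) | NP.+-suc j m | NP.+-comm j m =
    trans (B.attach-old _ _ (¬SameEdge (loFst j l) (inj₁ (Wne jM m<M (NP.<⇒≢ l))))
                            (¬SameEdge (inj₁ (Wne jM r<M (NP.<⇒≢ (NP.<-≤-trans l (m≤ m'))))) (loSnd j l)))
          (sym (W'hi l))
    where jM = loM l

  lo-prev : ∀ j → j < m → B.attach (W j) (W (prev M j)) ≡ W' (prev M' j)
  lo-prev zero l =
    trans (cong (λ z → B.attach (W 0) (W z)) prM0)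
    (trans (B.attach-second _ _ (¬SameEdge (inj₁ (Wne 0<M m'<M (λ e → m'≢0 (sym e)))) (inj₁ (Wne 0<M m<M (λ ()))))
                                (inj₂ (refl , refl)))
          (sym (trans (cong W' prM'0) W'y)))
  lo-prev (suc j') l =
    trans (B.attach-old _ _ (¬SameEdge (inj₂ (Wne (loM j'<m) m<M (NP.<⇒≢ j'<m))) (inj₁ (Wne (loM l) m<M (NP.<⇒≢ l))))
                            (¬SameEdge (inj₁ (Wne (loM l) r<M (NP.<⇒≢ (NP.<-≤-trans l (m≤ m')))))
                                       (inj₁ (Wne (loM l) 0<M (λ ())))))
          (sym (W'lo j'<m))
    where j'<m = NP.<-trans (NP.n<1+n j') l

  nbLo : ∀ {j} → j < m → Neighbours K' (W' j) (W' (next M' j)) (W' (opposite (suc m) j)) (W' (prev M' j))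
  nbLo {j} l = nbrs-subst (sym (W'lo l)) (nbrs-cong (lo-next l) (lo-opposite l) (lo-prev j l) (B.nbrs-old (nb (loM l))))

  next-M'-hi : ∀ {t} → t < m → next M' (suc (m + t)) ≡ suc (suc (m + t))
  next-M'-hi l = next-step λ e → NP.<-irrefl (NP.+-cancelˡ-≡ m _ _ (NP.suc-injective (NP.suc-injective (trans e M'≡)))) l

  hi-next : ∀ {t} → t < m → B.attach (W (m + t)) (W (next M (m + t))) ≡ W' (next M' (suc (m + t)))
  hi-next {t} l rewrite next-M'-hi l with t ℕ.≟ m'
  ... | yes refl = trans (cong (λ z → B.attach (W (m + m')) (W z)) scr)
    (trans (B.attach-second _ _ (¬SameEdge (inj₁ (Wne (hiM l) m'<M (λ e → m'≢m+t t (sym e))))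
                                           (inj₁ (Wne (hiM l) m<M (λ e → m≢m+m' (sym e)))))
                                (inj₁ (refl , refl)))
           (sym (trans (cong W' (cong suc (sym (NP.+-suc m m')))) W'y)))
  ... | no ne rewrite next-step {m = M} {a = m + t} (λ e → ne (NP.+-cancelˡ-≡ m _ _ (NP.suc-injective (trans e Ms)))) =
    trans (B.attach-old _ _ (¬SameEdge (inj₁ (Wne jM m'<M (λ e → m'≢m+t t (sym e))))
                                       (inj₂ (Wne sjM m'<M (λ e → NP.<-irrefl (sym e) (NP.<-≤-trans m'<m (NP.m≤n⇒m≤1+n (m≤ t)))))))
                            (¬SameEdge (inj₁ (Wne jM r<M (λ e → ne (NP.+-cancelˡ-≡ m _ _ e)))) (inj₁ (Wne jM 0<M (λ ())))))
          (trans (cong (λ z → old (W z)) (sym (NP.+-suc m t))) (sym (trans (cong W' (cong suc (sym (NP.+-suc m t)))) (W'hi st<m))))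
    where jM = hiM l
          st<m = NP.≤∧≢⇒< l (λ e → ne (NP.suc-injective e))
          sjM : suc (m + t) < M
          sjM = subst (_< M) (NP.+-suc m t) (hiM st<m)

  hi-opposite : ∀ {t} → t < m → B.attach (W (m + t)) (W (opposite m (m + t))) ≡ W' (opposite (suc m) (suc (m + t)))
  hi-opposite {t} l
    rewrite opposite-high {k = m} {a = m + t} (m≤ t) | opposite-high {k = suc m} {a = suc (m + t)} (s≤s (m≤ t))
          | NP.m+n∸m≡n m t =
    trans (B.attach-old _ _ (¬SameEdge (inj₁ (Wne (hiM l) m'<M (λ e → m'≢m+t t (sym e)))) (hiSnd t l))
                            (¬SameEdge (hiFst t l) (inj₁ (Wne (hiM l) 0<M (λ ())))))
          (sym (W'lo l))

  hi-prev : ∀ t → t < m → B.attach (W (m + t)) (W (prev M (m + t))) ≡ W' (prev M' (suc (m + t)))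
  hi-prev zero l rewrite NP.+-identityʳ m | NP.+-identityʳ m' = trans (B.attach-first _ _ (inj₂ (refl , refl))) (sym W'x)
  hi-prev (suc t') l =
    trans (cong (λ z → B.attach (W (m + suc t')) (W z)) (NP.+-suc m' t'))
    (trans (B.attach-old _ _ (¬SameEdge (inj₁ (Wne (hiM l) m'<M (λ e → m'≢m+t (suc t') (sym e))))
                                        (inj₁ (Wne (hiM l) m<M (NP.>⇒≢ (NP.m<m+n m (s≤s z≤n))))))
                             (¬SameEdge (inj₂ (Wne (hiM t'<m) 0<M (λ ()))) (inj₁ (Wne (hiM l) 0<M (λ ())))))
           (sym (trans (cong W' (NP.+-suc m t')) (W'hi t'<m))))
    where t'<m = NP.<-trans (NP.n<1+n t') l

  nbHi : ∀ {t} → t < m → Neighbours K' (W' (suc (m + t))) (W' (next M' (suc (m + t))))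
                                      (W' (opposite (suc m) (suc (m + t)))) (W' (prev M' (suc (m + t))))
  nbHi {t} l = nbrs-subst (sym (W'hi l)) (nbrs-cong (hi-next l) (hi-opposite l) (hi-prev t l) (B.nbrs-old (nb (hiM l))))

  W'sm : W' (suc m) ≡ old (W m)
  W'sm = trans (cong (λ z → W' (suc z)) (sym (NP.+-identityʳ m)))
           (trans (W'hi 0<m) (cong (λ z → old (W z)) (NP.+-identityʳ m)))

  nbX : Neighbours K' (W' m) (W' (next M' m)) (W' (opposite (suc m) m)) (W' (prev M' m))
  nbX = nbrs-subst (sym W'x) (nbrs-cong e1 e2 e3 (nbrs-rotate (nbrs-rotate B.nbrs-x)))
    where
    e1 : old (W m) ≡ W' (next M' m)
    e1 = sym (trans (cong W' (next-step {m = M'} {a = m} λ e → NP.<-irrefl refl (subst (_< M') e (subst (suc m <_) (sym M'≡) (s≤s (s≤s (m≤ m))))))) W'sm)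
    e2 : suc zero ≡ W' (opposite (suc m) m)
    e2 = sym (trans (cong W' (trans (opposite-low {k = suc m} {a = m} (NP.n<1+n m)) (NP.+-suc m m))) W'y)
    e3 : old (W m') ≡ W' (prev M' m)
    e3 = sym (W'lo m'<m)

  nbY : Neighbours K' (W' (suc (m + m))) (W' (next M' (suc (m + m)))) (W' (opposite (suc m) (suc (m + m)))) (W' (prev M' (suc (m + m))))
  nbY = nbrs-subst (sym W'y) (nbrs-cong e1 e2 e3 (nbrs-rotate (nbrs-rotate B.nbrs-y)))
    where
    e1 : old (W 0) ≡ W' (next M' (suc (m + m)))
    e1 = sym (trans (cong W' (next-wrap (sym M'≡))) (W'lo 0<m))
    e2 : zero ≡ W' (opposite (suc m) (suc (m + m)))
    e2 = sym (trans (cong W' (trans (opposite-high {k = suc m} {a = suc (m + m)} (s≤s (m≤ m))) (NP.m+n∸m≡n m m))) W'x)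
    e3 : old (W (m + m')) ≡ W' (prev M' (suc (m + m)))
    e3 = sym (trans (cong W' (NP.+-suc m m')) (W'hi m'<m))

  data NewV (a : ℕ) : Set where
    vlo : a < m → NewV a
    vx : a ≡ m → NewV a
    vhi : ∀ t → t < m → a ≡ suc (m + t) → NewV a
    vy : a ≡ suc (m + m) → NewV a

  newV : ∀ a → a < M' → NewV a
  newV a a< with a ℕ.<? m
  ... | yes l = vlo l
  ... | no nl with a ℕ.≟ m
  ...   | yes e = vx e
  ...   | no ne with NP.m+[n∸m]≡n {suc m} {a} (NP.≤∧≢⇒< (NP.≮⇒≥ nl) (λ e → ne (sym e)))
  ...     | eq with (a ∸ suc m) ℕ.≟ m
  ...       | yes e' = vy (trans (sym eq) (cong (λ z → suc (m + z)) e'))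
  ...       | no ne' = vhi (a ∸ suc m) (NP.≤∧≢⇒< t≤ ne') (sym eq)
    where
    t≤ : a ∸ suc m ≤ m
    t≤ = NP.+-cancelˡ-≤ (suc m) _ _ (subst (_≤ suc m + m) (sym eq)
           (NP.≤-pred (subst (a <_) M'≡ a<)))

  nb' : ∀ {a} → a < M' → Neighbours K' (W' a) (W' (next M' a)) (W' (opposite (suc m) a)) (W' (prev M' a))
  nb' {a} a< with newV a a<
  ... | vlo l = nbLo l
  ... | vx refl = nbX
  ... | vhi t l refl = nbHi l
  ... | vy refl = nbY

  private
    ss≢0 : ∀ {x : Fin N} → old x ≢ zero
    ss≢0 ()
    ss≢1 : ∀ {x : Fin N} → old x ≢ suc zero
    ss≢1 ()

  inj' : ∀ {a b} → a < M' → b < M' → W' a ≡ W' b → a ≡ b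
  inj' {a} {b} a< b< e with newV a a< | newV b b<
  ... | vlo l | vlo l' = inj (loM l) (loM l') (old-injective (trans (sym (W'lo l)) (trans e (W'lo l'))))
  ... | vlo l | vx refl = ⊥-elim (ss≢0 (trans (sym (W'lo l)) (trans e W'x)))
  ... | vlo l | vhi t l' refl = ⊥-elim (NP.<⇒≢ (NP.<-≤-trans l (m≤ t)) (inj (loM l) (hiM l') (old-injective (trans (sym (W'lo l)) (trans e (W'hi l'))))))
  ... | vlo l | vy refl = ⊥-elim (ss≢1 (trans (sym (W'lo l)) (trans e W'y)))
  ... | vx refl | vlo l' = ⊥-elim (ss≢0 (trans (sym (W'lo l')) (trans (sym e) W'x)))
  ... | vx refl | vx refl = refl
  ... | vx refl | vhi t l' refl = ⊥-elim (ss≢0 (trans (sym (W'hi l')) (trans (sym e) W'x)))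
  ... | vx refl | vy refl = ⊥-elim (0≢1 (trans (sym W'x) (trans e W'y)))
    where 0≢1 : zero ≢ suc {suc N} zero
          0≢1 ()
  ... | vhi t l refl | vlo l' = ⊥-elim (NP.<⇒≢ (NP.<-≤-trans l' (m≤ t)) (inj (loM l') (hiM l) (old-injective (trans (sym (W'lo l')) (trans (sym e) (W'hi l))))))
  ... | vhi t l refl | vx refl = ⊥-elim (ss≢0 (trans (sym (W'hi l)) (trans e W'x)))
  ... | vhi t l refl | vhi t' l' refl = cong (λ z → suc (m + z)) (NP.+-cancelˡ-≡ m _ _ (inj (hiM l) (hiM l') (old-injective (trans (sym (W'hi l)) (trans e (W'hi l'))))))
  ... | vhi t l refl | vy refl = ⊥-elim (ss≢1 (trans (sym (W'hi l)) (trans e W'y)))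
  ... | vy refl | vlo l' = ⊥-elim (ss≢1 (trans (sym (W'lo l')) (trans (sym e) W'y)))
  ... | vy refl | vx refl = ⊥-elim (0≢1 (trans (sym W'x) (trans (sym e) W'y)))
    where 0≢1 : zero ≢ suc {suc N} zero
          0≢1 ()
  ... | vy refl | vhi t' l' refl = ⊥-elim (ss≢1 (trans (sym (W'hi l')) (trans (sym e) W'y)))
  ... | vy refl | vy refl = refl

  cov' : ∀ v → Σ ℕ λ a → a < M' × v ≡ W' a
  cov' zero = m , mM' , sym W'x
  cov' (suc zero) = suc (m + m) , subst (suc (m + m) <_) (sym M'≡) (NP.n<1+n _) , sym W'y
  cov' (suc (suc w)) with cov w
  ... | j , j< , e with j ℕ.<? m
  ...   | yes l = j , NP.<-trans l mM' , trans (cong old e) (sym (W'lo l))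
  ...   | no nl = suc (m + t) , subst (suc (m + t) <_) (sym M'≡) (s≤s (s≤s (NP.+-monoʳ-≤ m (NP.<⇒≤ t<m)))) ,
                  trans (cong old (trans e (cong W (sym eq)))) (sym (W'hi t<m))
    where
    t = j ∸ m
    eq : m + t ≡ j
    eq = NP.m+[n∸m]≡n (NP.≮⇒≥ nl)
    t<m : t < m
    t<m = NP.+-cancelˡ-< m _ _ (subst (_< m + m) (sym eq) (subst (j <_) Mm j<))

  bridged-mobius : MobiusStructure K' (suc m) W'
  bridged-mobius = record { inj = inj' ; cov = cov' ; nb = nb' }

-- Closing up the rails

avoid-two : ∀ {N} → 3 ≤ N → (u v : Fin N) → Σ (Fin N) λ x → u ≢ x × v ≢ x
avoid-two {zero} () u v
avoid-two {suc zero} (s≤s ()) u v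
avoid-two {suc (suc zero)} (s≤s (s≤s ())) u v
avoid-two {suc (suc (suc k))} _ u v = pick-first (check zero) (check (suc zero)) (check (suc (suc zero)))
  where
  Avoiding = Σ (Fin (suc (suc (suc k)))) λ x → u ≢ x × v ≢ x
  check : (c : Fin (suc (suc (suc k)))) → Avoiding ⊎ (c ≡ u ⊎ c ≡ v)
  check c with dec u c
  ... | inj₁ e = inj₂ (inj₁ (sym e))
  ... | inj₂ a with dec v c
  ...   | inj₁ e = inj₂ (inj₂ (sym e))
  ...   | inj₂ b = inj₁ (c , a , b)
  pick-first : Avoiding ⊎ (zero ≡ u ⊎ zero ≡ v) → Avoiding ⊎ (suc zero ≡ u ⊎ suc zero ≡ v) → Avoiding ⊎ (suc (suc zero) ≡ u ⊎ suc (suc zero) ≡ v) → Avoiding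
  pick-first (inj₁ r) _ _ = r
  pick-first (inj₂ _) (inj₁ r) _ = r
  pick-first (inj₂ _) (inj₂ _) (inj₁ r) = r
  pick-first (inj₂ x) (inj₂ y) (inj₂ z) = ⊥-elim (no-three-in-two (λ ()) (λ ()) (λ ()) x y z)

adj-closed⇒everywhere : ∀ {N} {K : Graph (Fin N)} → TwoConnected K → (S : Fin N → Set) → ∀ {x0} → S x0 →
        (∀ v w → S v → K v w ≡ true → S w) → ∀ v → S v
adj-closed⇒everywhere {K = K} (n3 , walks) S {x0} s0 cl v with avoid-two n3 x0 v
... | x , a , b = walkS (walks x x0 v a b) s0
  where
  walkS : ∀ {p q} → WalkAvoiding K x p q → S p → S q
  walkS (nil _) sp = sp
  walkS (cons _ e w) sp = walkS w (cl _ _ sp e)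

injection-bound : ∀ {N} (f : Fin N → ℕ) B → (∀ v → f v < B) → (∀ v w → f v ≡ f w → v ≡ w) → N ≤ B
injection-bound f B lt inj = FP.injective⇒≤ {f = λ v → fromℕ< (lt v)}
  λ {v} {w} e → inj v w (trans (sym (FP.toℕ-fromℕ< (lt v))) (trans (cong toℕ e) (FP.toℕ-fromℕ< (lt w))))

8≤m+m⇒4≤m : ∀ m → 8 ≤ m + m → 4 ≤ m
8≤m+m⇒4≤m zero ()
8≤m+m⇒4≤m (suc zero) (s≤s (s≤s ()))
8≤m+m⇒4≤m (suc (suc zero)) (s≤s (s≤s (s≤s (s≤s ()))))
8≤m+m⇒4≤m (suc (suc (suc zero))) (s≤s (s≤s (s≤s (s≤s (s≤s (s≤s ()))))))
8≤m+m⇒4≤m (suc (suc (suc (suc k)))) _ = s≤s (s≤s (s≤s (s≤s z≤n)))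


module Classification {n : ℕ} (H : Graph (Fin n)) (simp : IsSimple H) (cub : Cubic H) (tf : TriangleFree H)
  (twoC : TwoConnected H) (n≥8 : 8 ≤ n) (P0 P1 R0 R1 : Fin n) where

  open CubicFacts H simp cub tf
  open Rungs H simp cub tf P0 P1 R0 R1
  open RepeatFacts H simp cub tf
  open Closure H simp cub tf P0 P1 R0 R1

  swapRails : State → State
  swapRails s = (proj₂ (proj₁ s) , proj₁ (proj₁ s)) , (proj₂ (proj₂ s) , proj₁ (proj₂ s))

  -- Square i restated on rung i, so that it can be transported along a period of the rails
  IsSquare : State → Set
  IsSquare s = (H (proj₁ (proj₁ s)) (proj₁ (proj₂ s)) ≡ true) × (H (proj₂ (proj₁ s)) (proj₂ (proj₂ s)) ≡ true) ×
           (H (proj₁ (proj₁ s)) (proj₂ (proj₁ s)) ≡ true) × (H (proj₁ (proj₂ s)) (proj₂ (proj₂ s)) ≡ true) ×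
           (proj₁ (proj₁ s) ≢ proj₂ (proj₂ s)) × (proj₁ (proj₂ s) ≢ proj₂ (proj₁ s))

  Square⇒IsSquare : ∀ {i} → Square i → IsSquare (rung i)
  Square⇒IsSquare I = ePP , eRR , ePR , ePR' , diag₁ , diag₂
    where open Square I
  IsSquare⇒Square : ∀ {i} → IsSquare (rung i) → Square i
  IsSquare⇒Square (a , b , c , d , e , f) = record { ePP = a ; eRR = b ; ePR = c ; ePR' = d ; diag₁ = e ; diag₂ = f }
  IsSquare-swap : ∀ {s} → IsSquare s → IsSquare (swapRails s)
  IsSquare-swap (a , b , c , d , e , f) = b , a , adj-sym c , adj-sym d , ≢-sym f , ≢-sym e

  fromClosed : Closed → Σ ℕ λ m' → 2 ≤ m' × suc m' ≤ n × Distinct P R (suc m') ×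
      ((P (suc m') ≡ P 0 × R (suc m') ≡ R 0) ⊎ (P (suc m') ≡ R 0 × R (suc m') ≡ P 0))
  fromClosed record { m = suc m' ; inj = I ; m≤n = l ; m≥3 = s≤s m'≥2 ; kind = k } = m' , m'≥2 , l , I , k

  module Periodic (all : SquaresUpTo n) (m' : ℕ) (m'≥2 : 2 ≤ m') (m≤n : suc m' ≤ n) (I : Distinct P R (suc m')) where
    m : ℕ
    m = suc m'
    open Distinct I

    m'<m : m' < m
    m'<m = NP.n<1+n m'
    0<m : 0 < m
    0<m = s≤s z≤n
    1<m : 1 < m
    1<m = s≤s (NP.≤-trans (s≤s z≤n) m'≥2)
    1≢m' : 1 ≢ m'
    1≢m' e = NP.<-irrefl e m'≥2
    square-m' : Square m'
    square-m' = all m' (NP.≤-trans (NP.<⇒≤ m'<m) m≤n)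
    nbrs-P[m] : Neighbours H (P m) (P m') (R m) (P (suc m))
    nbrs-P[m] = ThirdSpec.nbrs (thirdP square-m')
    nbrs-R[m] : Neighbours H (R m) (R m') (P m) (R (suc m))
    nbrs-R[m] = ThirdSpec.nbrs (thirdR square-m')
    square-0 : Square 0
    square-0 = all 0 z≤n

    squares-periodic : (shift : ∀ i → IsSquare (rung i) → IsSquare (rung (i + m))) → ∀ f i → i < f → Square i
    squares-periodic shift (suc f) i i< with i ℕ.≤? n
    ... | yes i≤n = all i i≤n
    ... | no i>n = subst Square eq (IsSquare⇒Square (shift (i ∸ m) (Square⇒IsSquare (squares-periodic shift f (i ∸ m) rail-index<))))
      where
      m≤i : m ≤ i
      m≤i = NP.≤-trans m≤n (NP.<⇒≤ (NP.≰⇒> i>n))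
      eq : (i ∸ m) + m ≡ i
      eq = NP.m∸n+n≡m m≤i
      rail-index< : i ∸ m < f
      rail-index< = NP.<-≤-trans (subst (i ∸ m <_) eq (NP.m<m+n (i ∸ m) 0<m)) (NP.≤-pred i<)

    next-m-0 : next m 0 ≡ 1
    next-m-0 = next-step λ e → NP.<-irrefl (NP.suc-injective e) (NP.≤-trans (s≤s z≤n) m'≥2)

    periodic-nbrs : (Pp Rr : ℕ → Fin n) → (∀ i → Neighbours H (Pp (suc i)) (Pp i) (Rr (suc i)) (Pp (suc (suc i)))) →
           Pp m ≡ Pp 0 → Rr m ≡ Rr 0 → Pp (suc m) ≡ Pp 1 →
           ∀ a → a < m → Neighbours H (Pp a) (Pp (next m a)) (Rr a) (Pp (prev m a))
    periodic-nbrs Pp Rr nb e0 e1 e2 zero _ =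
      nbrs-cong (cong Pp (sym next-m-0)) refl refl (nbrs-reverse (nbrs-subst e0 (nbrs-cong refl e1 e2 (nb m'))))
    periodic-nbrs Pp Rr nb e0 e1 e2 (suc a') l = nbrs-cong sce refl refl (nbrs-reverse (nb a'))
      where
      sce : Pp (suc (suc a')) ≡ Pp (next m (suc a'))
      sce with suc (suc a') ℕ.≟ m
      ... | yes e = trans (cong Pp e) (trans e0 (cong Pp (sym (next-wrap e))))
      ... | no ne = cong Pp (sym (next-step ne))

  module StraightCase (all : SquaresUpTo n) (m' : ℕ) (m'≥2 : 2 ≤ m') (m≤n : suc m' ≤ n) (I : Distinct P R (suc m'))
    (eP : P (suc m') ≡ P 0) (eR : R (suc m') ≡ R 0) where
    open Periodic all m' m'≥2 m≤n I
    open Distinct I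

    P[1+m]≡P[1] : P (suc m) ≡ P 1
    P[1+m]≡P[1] with Neighbours.only nbrs-P[m] (P 1) (subst (λ z → H z (P 1) ≡ true) (sym eP) (Square.ePP square-0))
    ... | inj₁ x = ⊥-elim (1≢m' (iPP 1<m m'<m x))
    ... | inj₂ (inj₁ x) = ⊥-elim (iPR 1<m 0<m (trans x eR))
    ... | inj₂ (inj₂ x) = sym x
    R[1+m]≡R[1] : R (suc m) ≡ R 1
    R[1+m]≡R[1] with Neighbours.only nbrs-R[m] (R 1) (subst (λ z → H z (R 1) ≡ true) (sym eR) (Square.eRR square-0))
    ... | inj₁ x = ⊥-elim (1≢m' (iRR 1<m m'<m x))
    ... | inj₂ (inj₁ x) = ⊥-elim (iPR 0<m 1<m (sym (trans x eP)))
    ... | inj₂ (inj₂ x) = sym x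

    periodic : ∀ i → rung (i + m) ≡ rung i
    periodic zero = cong₂ _,_ (cong₂ _,_ eP eR) (cong₂ _,_ P[1+m]≡P[1] R[1+m]≡R[1])
    periodic (suc i) = cong step (periodic i)

    all-squares : ∀ i → Square i
    all-squares i = squares-periodic (λ j x → subst IsSquare (sym (periodic j)) x) (suc i) i (NP.n<1+n i)

    nbP : ∀ {a} → a < m → Neighbours H (P a) (P (next m a)) (R a) (P (prev m a))
    nbP {a} = periodic-nbrs P R (λ i → ThirdSpec.nbrs (thirdP (all-squares i))) eP eR P[1+m]≡P[1] a
    nbR : ∀ {a} → a < m → Neighbours H (R a) (R (next m a)) (P a) (R (prev m a))
    nbR {a} = periodic-nbrs R P (λ i → ThirdSpec.nbrs (thirdR (all-squares i))) eR eP R[1+m]≡R[1] a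

    OnRails : Fin n → Set
    OnRails v = Σ ℕ λ a → a < m × (v ≡ P a ⊎ v ≡ R a)

    cov : ∀ v → OnRails v
    cov = adj-closed⇒everywhere twoC OnRails (0 , 0<m , inj₁ refl) adj-closed
      where
      adj-closed : ∀ v w → OnRails v → H v w ≡ true → OnRails w
      adj-closed v w (a , a< , inj₁ refl) e with Neighbours.only (nbP a<) w e
      ... | inj₁ x = next m a , next< a< , inj₁ x
      ... | inj₂ (inj₁ x) = a , a< , inj₂ x
      ... | inj₂ (inj₂ x) = prev m a , prev< a< , inj₁ x
      adj-closed v w (a , a< , inj₂ refl) e with Neighbours.only (nbR a<) w e
      ... | inj₁ x = next m a , next< a< , inj₂ x
      ... | inj₂ (inj₁ x) = a , a< , inj₁ x
      ... | inj₂ (inj₂ x) = prev m a , prev< a< , inj₂ x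

    ladder-structure : LadderStructure H m P R
    ladder-structure = record { injP = iPP ; injR = iRR ; injPR = iPR ; cov = cov ; nbP = nbP ; nbR = nbR }

    rail-index : Fin n → ℕ
    rail-index v with cov v
    ... | a , _ , inj₁ _ = a
    ... | a , _ , inj₂ _ = m + a

    vertex-bound : n ≤ m + m
    vertex-bound = injection-bound rail-index (m + m) rail-index< rail-index-injective
      where
      rail-index< : ∀ v → rail-index v < m + m
      rail-index< v with cov v
      ... | a , a< , inj₁ _ = NP.<-≤-trans a< (NP.m≤m+n m m)
      ... | a , a< , inj₂ _ = NP.+-monoʳ-< m a<
      rail-index-injective : ∀ v w → rail-index v ≡ rail-index w → v ≡ w
      rail-index-injective v w e with cov v | cov w
      ... | a , a< , inj₁ x | b , b< , inj₁ y = trans x (trans (cong P e) (sym y))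
      ... | a , a< , inj₂ x | b , b< , inj₂ y = trans x (trans (cong R (NP.+-cancelˡ-≡ m _ _ e)) (sym y))
      ... | a , a< , inj₁ x | b , b< , inj₂ y = ⊥-elim (NP.<-irrefl e (NP.<-≤-trans a< (NP.m≤m+n m b)))
      ... | a , a< , inj₂ x | b , b< , inj₁ y = ⊥-elim (NP.<-irrefl (sym e) (NP.<-≤-trans b< (NP.m≤m+n m a)))

    result : (G : Graph (Fin (suc (suc n)))) → G ≅ bridgeAt m' → Outcome G
    result G g = inj₁ (m , 8≤m+m⇒4≤m m (NP.≤-trans n≥8 vertex-bound) , ladderIso ladder-structure ,
      ≅-trans g (≅-trans (bridge-cong H refl eP refl eR) (ladderIso (BridgeLadder.bridged-ladder H simp m' P R ladder-structure m'≥2))))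

  module TwistedCase (all : SquaresUpTo n) (m' : ℕ) (m'≥2 : 2 ≤ m') (m≤n : suc m' ≤ n) (I : Distinct P R (suc m'))
    (eP : P (suc m') ≡ R 0) (eR : R (suc m') ≡ P 0) where
    open Periodic all m' m'≥2 m≤n I
    open Distinct I

    P[1+m]≡R[1] : P (suc m) ≡ R 1
    P[1+m]≡R[1] with Neighbours.only nbrs-P[m] (R 1) (subst (λ z → H z (R 1) ≡ true) (sym eP) (Square.eRR square-0))
    ... | inj₁ x = ⊥-elim (iPR m'<m 1<m (sym x))
    ... | inj₂ (inj₁ x) = ⊥-elim (iPR 0<m 1<m (sym (trans x eR)))
    ... | inj₂ (inj₂ x) = sym x
    R[1+m]≡P[1] : R (suc m) ≡ P 1
    R[1+m]≡P[1] with Neighbours.only nbrs-R[m] (P 1) (subst (λ z → H z (P 1) ≡ true) (sym eR) (Square.ePP square-0))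
    ... | inj₁ x = ⊥-elim (iPR 1<m m'<m x)
    ... | inj₂ (inj₁ x) = ⊥-elim (iPR 1<m 0<m (trans x eP))
    ... | inj₂ (inj₂ x) = sym x

    periodic-twisted : ∀ i → rung (i + m) ≡ swapRails (rung i)
    periodic-twisted zero = cong₂ _,_ (cong₂ _,_ eP eR) (cong₂ _,_ P[1+m]≡R[1] R[1+m]≡P[1])
    periodic-twisted (suc i) = cong step (periodic-twisted i)

    all-squares : ∀ i → Square i
    all-squares i = squares-periodic (λ j x → subst IsSquare (sym (periodic-twisted j)) (IsSquare-swap x)) (suc i) i (NP.n<1+n i)

    PR' : ∀ i → P (i + m) ≡ R i
    PR' i = cong (λ s → proj₁ (proj₁ s)) (periodic-twisted i)
    RP' : ∀ i → R (i + m) ≡ P i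
    RP' i = cong (λ s → proj₂ (proj₁ s)) (periodic-twisted i)
    P2 : ∀ i → P ((i + m) + m) ≡ P i
    P2 i = trans (PR' (i + m)) (RP' i)
    R2 : ∀ i → R ((i + m) + m) ≡ R i
    R2 i = trans (RP' (i + m)) (PR' i)

    M M1 : ℕ
    M = 2 * m
    M1 = m + m'
    eqM : M ≡ suc M1
    eqM = trans (2*≡+ m) (NP.+-suc m m')
    PM : P M ≡ P 0
    PM = trans (cong P (2*≡+ m)) (P2 0)
    0<M : 0 < M
    0<M = subst (0 <_) (sym eqM) (s≤s z≤n)

    antR : ∀ a → a < M → R a ≡ P (opposite m a)
    antR a a< with a ℕ.<? m
    ... | yes l = trans (sym (PR' a)) (cong P (sym (opposite-low l)))
    ... | no nl = trans (cong R (sym eq)) (trans (RP' (a ∸ m)) (cong P (sym (opposite-high (NP.≮⇒≥ nl)))))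
      where eq : (a ∸ m) + m ≡ a
            eq = NP.m∸n+n≡m (NP.≮⇒≥ nl)

    nbAllP : ∀ i → Neighbours H (P (suc i)) (P i) (R (suc i)) (P (suc (suc i)))
    nbAllP i = ThirdSpec.nbrs (thirdP (all-squares i))

    nb : ∀ {a} → a < M → Neighbours H (P a) (P (next M a)) (P (opposite m a)) (P (prev M a))
    nb {zero} _ = nbrs-cong e1 e2 e3 (nbrs-reverse (nbrs-subst u0 (nbrs-cong refl r0 p1 (nbAllP M1))))
      where
      u0 : P (suc M1) ≡ P 0
      u0 = trans (cong P (sym eqM)) PM
      r0 : R (suc M1) ≡ R 0
      r0 = trans (cong R (trans (sym eqM) (2*≡+ m))) (R2 0)
      p1 : P (suc (suc M1)) ≡ P 1
      p1 = trans (cong P (cong suc (trans (sym eqM) (2*≡+ m)))) (P2 1)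
      e1 : P 1 ≡ P (next M 0)
      e1 = cong P (sym (next-step λ e → NP.<-irrefl (NP.suc-injective (trans e eqM)) (NP.<-≤-trans (s≤s z≤n) (NP.m≤m+n m m'))))
      e2 : R 0 ≡ P (opposite m 0)
      e2 = antR 0 0<M
      e3 : P M1 ≡ P (prev M 0)
      e3 = cong P (cong (_∸ 1) (sym eqM))
    nb {suc a'} a< = nbrs-cong sce (antR (suc a') a<) refl (nbrs-reverse (nbAllP a'))
      where
      sce : P (suc (suc a')) ≡ P (next M (suc a'))
      sce with suc (suc a') ℕ.≟ M
      ... | yes e = trans (cong P e) (trans PM (cong P (sym (next-wrap e))))
      ... | no ne = cong P (sym (next-step ne))

    OnRails : Fin n → Set
    OnRails v = Σ ℕ λ a → a < M × v ≡ P a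

    cov : ∀ v → OnRails v
    cov = adj-closed⇒everywhere twoC OnRails (0 , 0<M , refl) adj-closed
      where
      adj-closed : ∀ v w → OnRails v → H v w ≡ true → OnRails w
      adj-closed v w (a , a< , refl) e with Neighbours.only (nb a<) w e
      ... | inj₁ x = next M a , next< a< , x
      ... | inj₂ (inj₁ x) = opposite m a , opposite< {m} a< , x
      ... | inj₂ (inj₂ x) = prev M a , prev< a< , x

    viewM : ∀ a → a < M → a < m ⊎ (Σ ℕ λ t → t < m × a ≡ t + m)
    viewM a a< with a ℕ.<? m
    ... | yes l = inj₁ l
    ... | no nl = inj₂ (a ∸ m , NP.+-cancelʳ-< m _ _ (subst (_< m + m) (sym eq) (subst (a <_) (2*≡+ m) a<)) , sym eq)
      where eq : (a ∸ m) + m ≡ a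
            eq = NP.m∸n+n≡m (NP.≮⇒≥ nl)

    injW : ∀ {a b} → a < M → b < M → P a ≡ P b → a ≡ b
    injW {a} {b} a< b< e with viewM a a< | viewM b b<
    ... | inj₁ x | inj₁ y = iPP x y e
    ... | inj₁ x | inj₂ (t , t< , refl) = ⊥-elim (iPR x t< (trans e (PR' t)))
    ... | inj₂ (t , t< , refl) | inj₁ y = ⊥-elim (iPR y t< (trans (sym e) (PR' t)))
    ... | inj₂ (t , t< , refl) | inj₂ (t' , t'< , refl) =
      cong (_+ m) (iRR t< t'< (trans (sym (PR' t)) (trans e (PR' t'))))

    mobius-structure : MobiusStructure H m P
    mobius-structure = record { inj = injW ; cov = cov ; nb = nb }

    vertex-bound : n ≤ 2 * m
    vertex-bound = injection-bound (λ v → proj₁ (cov v)) M (λ v → proj₁ (proj₂ (cov v)))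
      λ v w e → trans (proj₂ (proj₂ (cov v))) (trans (cong P e) (sym (proj₂ (proj₂ (cov w)))))

    result : (G : Graph (Fin (suc (suc n)))) → G ≅ bridgeAt m' → Outcome G
    result G g = inj₂ (inj₁ (m , 8≤m+m⇒4≤m m (subst (8 ≤_) (2*≡+ m) (NP.≤-trans n≥8 vertex-bound)) , mobiusIso mobius-structure ,
      ≅-trans g (≅-trans (bridge-cong H refl refl rr eR) (mobiusIso (BridgeMobius.bridged-mobius H simp m' P mobius-structure m'≥2)))))
      where
      rr : R m' ≡ P (m + m')
      rr = trans (sym (PR' m')) (cong P (NP.+-comm m' m))

  private
    <⇒≤n : ∀ {i m'} → i < m' → suc m' ≤ n → i ≤ n
    <⇒≤n i<m' m<n = NP.≤-trans (NP.<⇒≤ i<m') (NP.≤-trans (NP.n≤1+n _) m<n)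

  classify : Square 0 → (G : Graph (Fin (suc (suc n)))) → G ≅ bridgeAt 0 → Outcome G
  classify square0 G g0 with Iterate.iterate G g0 square0 n
  ... | inj₁ outcome = outcome
  ... | inj₂ all with fromClosed (closure all)
  ...   | m' , m'≥2 , m<n , I , inj₁ (eP , eR) = StraightCase.result all m' m'≥2 m<n I eP eR G
          (Iterate.≅bridgeAt G g0 square0 m' (λ i i<m' → all i (<⇒≤n i<m' m<n)))
  ...   | m' , m'≥2 , m<n , I , inj₂ (eP , eR) = TwistedCase.result all m' m'≥2 m<n I eP eR G
          (Iterate.≅bridgeAt G g0 square0 m' (λ i i<m' → all i (<⇒≤n i<m' m<n)))

theorem3p1 : (n : ℕ) (H : Graph (Fin n)) → IsSimple H → Cubic H →
    TriangleFree H → TwoConnected H → 8 ≤ n →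
    (a b c d : Fin n) → Edge H a b → Edge H c d →
    SpreadAtLeast11 H a b c d →
    (∃[ k ] (4 ≤ k × H ≅ Ladder k × bridge H a b c d ≅ Ladder (suc k)))
    ⊎ (∃[ k ] (4 ≤ k × H ≅ Mobius k × bridge H a b c d ≅ Mobius (suc k)))
    ⊎ (∃[ a' ] ∃[ b' ] ∃[ c' ] ∃[ d' ]
    (Edge H a' b' × Edge H c' d' × SpreadAtLeast12 H a' b' c' d' ×
    bridge H a b c d ≅ bridge H a' b' c' d'))
theorem3p1 n H simp cub tf twoC n≥8 a b c d eab ecd sp@(ac , ad , bc , bd) with linked-or-spread12 sp
  where open Simple simp
... | inj₂ sp12 = inj₂ (inj₂ (a , b , c , d , eab , ecd , sp12 , ≅-refl))
... | inj₁ (inj₁ (eac , ebd)) = classify b a d c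
        (record { ePP = adj-sym eab ; eRR = adj-sym ecd ; ePR = ebd ; ePR' = eac ; diag₁ = bc ; diag₂ = ad })
        (bridge H a b c d) (≅-trans (bridge-swapˡ H a b c d) (bridge-swapʳ H b a c d))
  where open Simple simp
        open Classification H simp cub tf twoC n≥8
... | inj₁ (inj₂ (ead , ebc)) = classify b a c d
        (record { ePP = adj-sym eab ; eRR = ecd ; ePR = ebc ; ePR' = ead ; diag₁ = bd ; diag₂ = ac })
        (bridge H a b c d) (bridge-swapˡ H a b c d)
  where open Simple simp
        open Classification H simp cub tf twoC n≥8
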